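{- Let $P_n$ be the path with $n$ vertices, where $n\geq 1$. Then \[P_{P_n}^{\times}(z)=\begin{cases}\left(\frac{2^{n}-1}{3}\right)z^{n-1}+\left(\frac{2^{n+1}+1}{3}\right)z^{n}, & \text{if } n \text{ is even},\\[2pt] \left(\frac{2^{n}+1}{3}\right)z^{n-1}+\left(\frac{2^{n+1}-1}{3}\right)z^{n}, & \text{if } n \text{ is odd}.\end{cases}\]
   Context: A ribbon graph $G$ is a surface with boundary formed from vertex discs and edge discs (ribbons), each edge attached to vertex discs along two disjoint arcs; $v,e,f,c$ denote numbers of vertices, edges, boundary components and connected components, and the Euler genus is $\varepsilon=2c-v+e-f$. For $A\subseteq E(G)$, the partial Petrial $G^{\times|A}$ is obtained by adding a half-twist to each edge in $A$, and ${^\partial\varepsilon^{\times}_{G}(z)}=\sum_{A\subseteq E(G)} z^{\varepsilon(G^{\times|A})}$. A bouquet is a ribbon graph with one vertex; two loops are interlaced if their ends alternate around the vertex boundary; the intersection graph $I(B)$ has vertex set $E(B)$ with adjacency meaning interlaced. A circle graph is a graph $I(B)$ for some bouquet $B$, and for a circle graph $G$, $P_G^{\times}(z):={^\partial\varepsilon^{\times}_{B}(z)}$ for any bouquet $B$ with $I(B)=G$ (independent of the choice of $B$). -}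

module Defs where

open import Data.Nat using (_⊓_; _⊔_; ℕ; zero; suc; _+_; _*_; _∸_; _^_; _<_; _≡ᵇ_; _≤ᵇ_)
open import Data.Nat.DivMod using (_mod_; _/_; _%_)
open import Data.Bool using (Bool; true; false; not; _xor_; if_then_else_; _∧_)
open import Data.Fin using (Fin; toℕ)
open import Data.Fin.Subset using (Subset)
open import Data.Vec using (Vec; []; _∷_; lookup)
open import Data.List using (List; []; _∷_; _++_; map; allFin; concatMap; upTo)
open import Data.Bool.ListAction using (and)
open import Data.Product using (_×_; _,_; proj₁; proj₂; ∃; Σ)
open import Data.Sum using (_⊎_)
open import Function.Bundles using (_↔_; Inverse; _⇔_)
open import Relation.Binary.PropositionalEquality using (_≡_)

-- The boundary of the single vertex disc is cut into 2m arcs at which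
-- edge ends are attached; these arcs are numbered 0 .. 2m-1 in the
-- (fixed, "positive") cyclic order around the vertex.  Each edge e has
-- two ends (e , true) and (e , false), and `ends` is a bijection between
-- edge ends and attachment positions.  `twist e` records whether the
-- ribbon of e carries a half-twist (relative to the vertex orientation).

record Bouquet (m : ℕ) : Set where
  field
    ends  : (Fin m × Bool) ↔ Fin (m + m)
    twist : Fin m → Bool

  endPos : Fin m × Bool → Fin (m + m)
  endPos = Inverse.to ends

  endAt : Fin (m + m) → Fin m × Bool
  endAt = Inverse.from ends

open Bouquet public

vertices components : ℕ
vertices = 1
components = 1

cyc+ : ∀ {k} → Fin k → Fin k
cyc+ {suc k} i = suc (toℕ i) mod suc k

cyc- : ∀ {k} → Fin k → Fin k
cyc- {suc k} i = (toℕ i + k) mod suc k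

-- Corner c (c : Fin (2m)) is the arc of the vertex boundary between the
-- end attached at position c and the end at position c+1 (mod 2m).
-- A state (c , d) means: traversing corner c in direction d
-- (true = from position c to c+1, false = from c+1 to c).
-- `faceStep` moves to the next corner met along the boundary: arrive at
-- an edge end, run along the side of the ribbon to the other end, and
-- continue along the next corner; a half-twist reverses the direction.

faceStep : ∀ {m} → Bouquet m → Fin (m + m) × Bool → Fin (m + m) × Bool
faceStep B (c , d) =
  let a  = if d then cyc+ c else c
      es = endAt B a
      b  = endPos B (proj₁ es , not (proj₂ es))
      d' = d xor twist B (proj₁ es)
  in (if d' then b else cyc- b) , d'

iter : ∀ {A : Set} → (A → A) → ℕ → A → A
iter f zero x = x
iter f (suc k) x = f (iter f k x)

countB : ∀ {A : Set} → (A → Bool) → List A → ℕ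
countB p [] = 0
countB p (x ∷ xs) = (if p x then 1 else 0) + countB p xs

states : ∀ m → List (Fin (m + m) × Bool)
states m = concatMap (λ c → (c , true) ∷ (c , false) ∷ []) (allFin (m + m))

code : ∀ {m} → Fin (m + m) × Bool → ℕ
code (c , d) = 2 * toℕ c + (if d then 1 else 0)

-- number of orbits of faceStep (a permutation of a set of 4m states):
-- count the states that have minimal code within their orbit.
orbits : ∀ {m} → Bouquet m → ℕ
orbits {m} B =
  countB (λ s → and (map (λ k → code {m} s ≤ᵇ code {m} (iter (faceStep B) k s))
                         (upTo (4 * m))))
         (states m)

-- number of boundary components: each boundary component is traced
-- exactly twice (once in each direction); a bouquet with no edges is
-- a disc with one boundary component.
faces : ∀ {m} → Bouquet m → ℕ
faces {zero}  B = 1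
faces {suc m} B = orbits B / 2

eulerGenus : ∀ {m} → Bouquet m → ℕ
eulerGenus {m} B = (2 * components + m) ∸ (vertices + faces B)

partialPetrial : ∀ {m} → Bouquet m → Subset m → Bouquet m
partialPetrial B A = record { ends = ends B ; twist = λ e → twist B e xor lookup A e }

allSubsets : ∀ n → List (Subset n)
allSubsets zero = [] ∷ []
allSubsets (suc n) = map (true ∷_) (allSubsets n) ++ map (false ∷_) (allSubsets n)

-- coefficient of z^k in  ∂ε^×_B(z) = Σ_{A ⊆ E(B)} z^{ε(B^{×|A})}
petrialPolyCoeff : ∀ {m} → Bouquet m → ℕ → ℕ
petrialPolyCoeff {m} B k =
  countB (λ A → eulerGenus (partialPetrial B A) ≡ᵇ k) (allSubsets m)

lo hi : ∀ {m} → Bouquet m → Fin m → ℕ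
lo B e = toℕ (endPos B (e , true)) ⊓ toℕ (endPos B (e , false))
hi B e = toℕ (endPos B (e , true)) ⊔ toℕ (endPos B (e , false))

Interlaced : ∀ {m} → Bouquet m → Fin m → Fin m → Set
Interlaced B e f =
    (lo B e < lo B f × lo B f < hi B e × hi B e < hi B f)
  ⊎ (lo B f < lo B e × lo B e < hi B f × hi B f < hi B e)

PathAdj : ∀ {n} → Fin n → Fin n → Set
PathAdj i j = (toℕ j ≡ suc (toℕ i)) ⊎ (toℕ i ≡ suc (toℕ j))

IntersectionGraphIsPath : ∀ {n} → Bouquet n → Set
IntersectionGraphIsPath {n} B =
  Σ (Fin n ↔ Fin n) λ σ →
    ∀ e f → Interlaced B e f ⇔ PathAdj (Inverse.to σ e) (Inverse.to σ f)

pathTarget : ℕ → ℕ → ℕ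
pathTarget n k =
  if n % 2 ≡ᵇ 0
  then (if k ≡ᵇ n ∸ 1 then (2 ^ n ∸ 1) / 3
        else if k ≡ᵇ n then (2 ^ (n + 1) + 1) / 3 else 0)
  else (if k ≡ᵇ n ∸ 1 then (2 ^ n + 1) / 3
        else if k ≡ᵇ n then (2 ^ (n + 1) ∸ 1) / 3 else 0)

-- Number the edge ends of B^{×|A} around its vertex: it becomes a chord diagram whose
-- chords form the path P_n, with twists t₁ … tₙ in path order, and its boundary
-- components are the orbits of face tracing, each traced once in each direction.
-- Removing a leaf of the path preserves the number of orbits: a twisted leaf can be
-- deleted once the twist of its neighbour is toggled, an untwisted leaf together with
-- its neighbour.  These are the recurrences of the continuant K(t₁ … tₙ) over GF(2),
-- so B^{×|A} has one boundary component when K = 1 and two when K = 0, i.e. Euler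
-- genus n or n - 1.  As A ↦ t is a bijection, the coefficient of z^{n-1} is the number
-- a(n) of twist vectors with K = 0, and a(n + 2) = a(n + 1) + 2 a(n) gives
-- 3 a(n) = 2ⁿ ∓ 1.

{-# OPTIONS --safe #-}
module Submission where

open import Data.Bool using (Bool; true; false; not; _xor_; _∧_; _∨_; if_then_else_; T)
open import Data.Bool.ListAction using (and)
open import Data.Bool.Properties using (∧-conicalˡ; ∧-conicalʳ; ∨-zeroʳ; ∨-comm; not-distribˡ-xor; not-involutive; xor-same; xor-comm; xor-identityʳ; true-xor) renaming (_≟_ to _≟ᵇ_)
open import Data.Empty using (⊥; ⊥-elim)
open import Data.Fin as Fin using (Fin; toℕ; fromℕ<)
open import Data.Fin.Properties using (pigeonhole; toℕ-fromℕ<; toℕ<n; toℕ-injective)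
open import Data.Fin.Subset using (Subset)
open import Data.List using (List; []; _∷_; _++_; map; applyUpTo; concatMap; upTo)
import Data.List as List
open import Data.Nat
open import Data.Nat.DivMod using (_mod_; _%_; _/_; m%n<n; m≡m%n+[m/n]*n; m<n⇒m%n≡m; n%n≡0; [m+n]%n≡m%n; m*n/n≡m)
open import Data.Nat.Induction using (<-rec)
open import Data.Nat.Properties
open import Algebra.Properties.CommutativeSemigroup +-commutativeSemigroup using (interchange)
open import Data.Nat.Solver using (module +-*-Solver)
open import Data.Product using (∃; _×_; _,_; proj₁; proj₂; map₁)
open import Data.Product.Properties using (≡-dec)
open import Data.Sum using (_⊎_; inj₁; inj₂)
open import Data.Unit using (⊤; tt)
open import Data.Vec using (Vec; []; _∷_; toList; lookup; tabulate)
open import Data.Vec.Properties using (tabulate-cong; lookup∘tabulate; tabulate∘lookup) renaming (≡-dec to ≡-dec-Vec)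
open import Function using (_∘′_; id; case_of_)
open import Function.Bundles using (_↔_; Inverse; _⇔_; Equivalence)
open import Relation.Binary.Definitions using (DecidableEquality; Tri; tri<; tri≈; tri>)
open import Relation.Binary.PropositionalEquality
open import Relation.Nullary using (yes; no; Dec; does)
open import Relation.Nullary.Decidable using (_×-dec_; _⊎-dec_; _→-dec_; True; toWitness; dec-true; dec-false)
open +-*-Solver using (solve; _:+_; _:*_; _:=_; con)
open import Defs

true≢false : true ≢ false
true≢false ()

≡⇒≡ᵇ-true : ∀ {m n} → m ≡ n → (m ≡ᵇ n) ≡ true
≡⇒≡ᵇ-true {m} {n} m≡n with m ≡ᵇ n in eq | ≡⇒≡ᵇ m n m≡n
... | true | _ = refl

≢⇒≡ᵇ-false : ∀ {m n} → m ≢ n → (m ≡ᵇ n) ≡ false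
≢⇒≡ᵇ-false {m} {n} m≢n with m ≡ᵇ n in eq
... | true  = ⊥-elim (m≢n (≡ᵇ⇒≡ m n (subst T (sym eq) tt)))
... | false = refl

<⇒<ᵇ-true : ∀ {m n} → m < n → (m <ᵇ n) ≡ true
<⇒<ᵇ-true {m} {n} m<n with m <ᵇ n in eq | <⇒<ᵇ m<n
... | true | _ = refl

≥⇒<ᵇ-false : ∀ {m n} → n ≤ m → (m <ᵇ n) ≡ false
≥⇒<ᵇ-false {m} {n} n≤m with m <ᵇ n in eq
... | true  = ⊥-elim (<⇒≱ (<ᵇ⇒< m n (subst T (sym eq) tt)) n≤m)
... | false = refl

≤⇒≤ᵇ-true : ∀ {m n} → m ≤ n → (m ≤ᵇ n) ≡ true
≤⇒≤ᵇ-true {m} {n} m≤n with m ≤ᵇ n in eq | ≤⇒≤ᵇ m≤n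
... | true | _ = refl

>⇒≤ᵇ-false : ∀ {m n} → n < m → (m ≤ᵇ n) ≡ false
>⇒≤ᵇ-false {m} {n} n<m with m ≤ᵇ n in eq
... | true  = ⊥-elim (<⇒≱ n<m (≤ᵇ⇒≤ m n (subst T (sym eq) tt)))
... | false = refl

≡ᵇ-true⇒≡ : ∀ {m n} → (m ≡ᵇ n) ≡ true → m ≡ n
≡ᵇ-true⇒≡ {m} {n} eq = ≡ᵇ⇒≡ m n (subst T (sym eq) tt)

≤ᵇ-true⇒≤ : ∀ {m n} → (m ≤ᵇ n) ≡ true → m ≤ n
≤ᵇ-true⇒≤ {m} {n} eq = ≤ᵇ⇒≤ m n (subst T (sym eq) tt)

<ᵇ-true⇒< : ∀ {m n} → (m <ᵇ n) ≡ true → m < n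
<ᵇ-true⇒< {m} {n} eq = <ᵇ⇒< m n (subst T (sym eq) tt)

<ᵇ-false⇒≥ : ∀ {m n} → (m <ᵇ n) ≡ false → n ≤ m
<ᵇ-false⇒≥ eq = ≮⇒≥ (λ m<n → subst T eq (<⇒<ᵇ m<n))

next : ℕ → ℕ → ℕ
next n a = if suc a ≡ᵇ n then 0 else suc a

prev : ℕ → ℕ → ℕ
prev n zero    = n ∸ 1
prev n (suc a) = a

next-wrap : ∀ {n a} → suc a ≡ n → next n a ≡ 0
next-wrap e rewrite ≡⇒≡ᵇ-true e = refl

next-nowrap : ∀ {n a} → suc a ≢ n → next n a ≡ suc a
next-nowrap e rewrite ≢⇒≡ᵇ-false e = refl

next< : ∀ {n a} → a < n → next n a < n
next< {n} {a} a<n with suc a ≟ n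
... | yes e rewrite next-wrap e = ≤-trans (s≤s z≤n) a<n
... | no e  rewrite next-nowrap e = ≤∧≢⇒< a<n e

prev< : ∀ {n a} → a < n → prev n a < n
prev< {suc n} {zero}  _   = ≤-refl
prev< {n}     {suc a} a<n = <-trans (n<1+n a) a<n

prev-next : ∀ {n a} → a < n → prev n (next n a) ≡ a
prev-next {n} {a} _ with suc a ≟ n
... | yes e rewrite next-wrap e = cong (_∸ 1) (sym e)
... | no e  rewrite next-nowrap e = refl

next-prev : ∀ {n a} → a < n → next n (prev n a) ≡ a
next-prev {suc n} {zero}  _   = next-wrap {suc n} {n} refl
next-prev {n}     {suc a} a<n = next-nowrap λ e → <-irrefl e a<n

next-injective : ∀ {n a b} → a < n → b < n → next n a ≡ next n b → a ≡ b
next-injective {n} a<n b<n e = trans (sym (prev-next a<n)) (trans (cong (prev n) e) (prev-next b<n))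

prev-injective : ∀ {n a b} → a < n → b < n → prev n a ≡ prev n b → a ≡ b
prev-injective {n} a<n b<n e = trans (sym (next-prev a<n)) (trans (cong (next n) e) (next-prev b<n))

iter-+ : ∀ {A : Set} (f : A → A) i j x → iter f (i + j) x ≡ iter f i (iter f j x)
iter-+ f zero    j x = refl
iter-+ f (suc i) j x = cong f (iter-+ f i j x)

iter-* : ∀ {A : Set} (f : A → A) {p x} → iter f p x ≡ x → ∀ k → iter f (k * p) x ≡ x
iter-* f         e zero    = refl
iter-* f {p} {x} e (suc k) = trans (iter-+ f p (k * p) x) (trans (cong (iter f p) (iter-* f e k)) e)

iter-preserves : ∀ {A : Set} (f : A → A) (P : A → Set) → (∀ {x} → P x → P (f x)) →
  ∀ i {x} → P x → P (iter f i x)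
iter-preserves f P pf zero    px = px
iter-preserves f P pf (suc i) px = pf (iter-preserves f P pf i px)

-- Face tracing in chord diagrams

-- Positions 0 … size - 1 are the attachment points of edge ends around the vertex,
-- and mate a is the other end of the edge at a.  A state (a , d) is the boundary
-- reaching the end at a while travelling in direction d (true = increasing positions);
-- step follows the edge to its other end and moves on to the neighbouring position,
-- in the same direction unless the edge is twisted.
record Diagram : Set where
  constructor diagram
  field
    size    : ℕ
    mate    : ℕ → ℕ
    twisted : ℕ → Bool
open Diagram public

State : Set
State = ℕ × Bool

step : Diagram → State → State
step D (a , d) =
  let d′ = d xor twisted D a in (if d′ then next (size D) (mate D a) else prev (size D) (mate D a)) , d′

InRange : Diagram → State → Set
InRange D s = proj₁ s < size D

Reaches : Diagram → State → State → Set
Reaches D s t = ∃ λ j → iter (step D) j s ≡ t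

record Valid (D : Diagram) : Set where
  field
    mate<           : ∀ {a} → a < size D → mate D a < size D
    mate-involutive : ∀ {a} → a < size D → mate D (mate D a) ≡ a
    mate≢           : ∀ {a} → a < size D → mate D a ≢ a
    twisted-mate    : ∀ {a} → a < size D → twisted D (mate D a) ≡ twisted D a

  mate-injective : ∀ {a b} → a < size D → b < size D → mate D a ≡ mate D b → a ≡ b
  mate-injective a< b< e = trans (sym (mate-involutive a<)) (trans (cong (mate D) e) (mate-involutive b<))

  mate-≡ᵇ : ∀ {a b} → a < size D → b < size D → (mate D a ≡ᵇ b) ≡ (a ≡ᵇ mate D b)
  mate-≡ᵇ {a} {b} a< b< with a ≟ mate D b
  ... | yes e = trans (≡⇒≡ᵇ-true (trans (cong (mate D) e) (mate-involutive b<))) (sym (≡⇒≡ᵇ-true e))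
  ... | no ne = trans (≢⇒≡ᵇ-false (λ e → ne (trans (sym (mate-involutive a<)) (cong (mate D) e)))) (sym (≢⇒≡ᵇ-false ne))

-- A labelling of the states that is constant on orbits of step, separates them and
-- takes exactly L values: it witnesses that step has exactly L orbits.
record OrbitLabelling (D : Diagram) (L : ℕ) : Set where
  field
    label         : State → ℕ
    label<        : ∀ {s} → InRange D s → label s < L
    label-step    : ∀ {s} → InRange D s → label (step D s) ≡ label s
    label⇒reaches : ∀ {s t} → InRange D s → InRange D t → label s ≡ label t → Reaches D s t
    label-onto    : ∀ {l} → l < L → ∃ λ s → InRange D s × label s ≡ l

reaches-refl : ∀ {D s} → Reaches D s s
reaches-refl = 0 , refl

reaches-step : ∀ {D s} → Reaches D s (step D s)
reaches-step = 1 , refl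

reaches-trans : ∀ {D s t u} → Reaches D s t → Reaches D t u → Reaches D s u
reaches-trans {D} {s} (i , e) (j , e′) = j + i , trans (iter-+ (step D) j i s) (trans (cong (iter (step D) j) e) e′)

module _ {D : Diagram} (V : Valid D) where
  open Valid V

  step-inRange : ∀ {s} → InRange D s → InRange D (step D s)
  step-inRange {a , d} a< with d xor twisted D a
  ... | true  = next< (mate< a<)
  ... | false = prev< (mate< a<)

  iter-inRange : ∀ i {s} → InRange D s → InRange D (iter (step D) i s)
  iter-inRange i = iter-preserves (step D) (InRange D) (λ {s} → step-inRange {s}) i

  step-injective : ∀ {s t} → InRange D s → InRange D t → step D s ≡ step D t → s ≡ t
  step-injective {a , d} {b , e} a< b< eq = cong₂ _,_ a≡b (xor-cancelʳ d e (trans (cong proj₂ eq) (cong (λ c → e xor twisted D c) (sym a≡b))))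
    where
    same-mate : ∀ x y → x ≡ y → (if x then next (size D) (mate D a) else prev (size D) (mate D a))
                                ≡ (if y then next (size D) (mate D b) else prev (size D) (mate D b)) → mate D a ≡ mate D b
    same-mate true  .true  refl q = next-injective (mate< a<) (mate< b<) q
    same-mate false .false refl q = prev-injective (mate< a<) (mate< b<) q
    a≡b : a ≡ b
    a≡b = mate-injective a< b< (same-mate _ _ (cong proj₂ eq) (cong proj₁ eq))
    xor-cancelʳ : ∀ x y {z} → x xor z ≡ y xor z → x ≡ y
    xor-cancelʳ false false _ = refl
    xor-cancelʳ true  true  _ = refl
    xor-cancelʳ false true  {false} ()
    xor-cancelʳ false true  {true}  ()
    xor-cancelʳ true  false {false} ()
    xor-cancelʳ true  false {true}  ()

  iter-injective : ∀ i {s t} → InRange D s → InRange D t → iter (step D) i s ≡ iter (step D) i t → s ≡ t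
  iter-injective zero    _  _  e = e
  iter-injective (suc i) s< t< e = iter-injective i s< t< (step-injective (iter-inRange i s<) (iter-inRange i t<) e)

bit : Bool → ℕ
bit b = if b then 1 else 0

encode : State → ℕ
encode (a , d) = 2 * a + bit d

encode-suc : ∀ a d → encode (suc a , d) ≡ 2 + encode (a , d)
encode-suc a d = cong (_+ bit d) (*-suc 2 a)

encode-injective : ∀ s t → encode s ≡ encode t → s ≡ t
encode-injective (zero  , false) (zero  , false) _ = refl
encode-injective (zero  , true)  (zero  , true)  _ = refl
encode-injective (suc a , d)     (suc b , e)     eq =
  cong (map₁ suc) (encode-injective (a , d) (b , e)
    (suc-injective (suc-injective (trans (sym (encode-suc a d)) (trans eq (encode-suc b e))))))
encode-injective (suc a , d) (zero , false) eq with () ← trans (sym (encode-suc a d)) eq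
encode-injective (suc a , d) (zero , true)  eq with () ← trans (sym (encode-suc a d)) eq
encode-injective (zero , false) (suc b , e) eq with () ← trans eq (encode-suc b e)
encode-injective (zero , true)  (suc b , e) eq with () ← trans eq (encode-suc b e)

encode< : ∀ {n} s → proj₁ s < n → encode s < 2 * n
encode< {n} (a , d) a<n = begin-strict
  2 * a + bit d ≤⟨ +-monoʳ-≤ (2 * a) (bit≤1 d) ⟩
  2 * a + 1     <⟨ +-monoʳ-< (2 * a) (n<1+n 1) ⟩
  2 * a + 2     ≡⟨ +-comm (2 * a) 2 ⟩
  2 + 2 * a     ≡⟨ sym (*-suc 2 a) ⟩
  2 * suc a     ≤⟨ *-monoʳ-≤ 2 a<n ⟩
  2 * n         ∎
  where
  open ≤-Reasoning
  bit≤1 : ∀ d → bit d ≤ 1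
  bit≤1 false = z≤n
  bit≤1 true  = ≤-refl

module _ {D : Diagram} (V : Valid D) where

  private
    visit : ∀ {s} → InRange D s → Fin (suc (2 * size D)) → Fin (2 * size D)
    visit {s} s< k = fromℕ< (encode< (iter (step D) (toℕ k) s) (iter-inRange V (toℕ k) s<))

  periodic : ∀ {s} → InRange D s → ∃ λ p → 1 ≤ p × p ≤ 2 * size D × iter (step D) p s ≡ s
  periodic {s} s< with i , j , i<j , fi≡fj ← pigeonhole (n<1+n (2 * size D)) (visit s<) =
    j′ ∸ i′ , m<n⇒0<n∸m i<j , ≤-trans (m∸n≤m j′ i′) (≤-pred (toℕ<n j)) , sym returns
    where
    i′ = toℕ i
    j′ = toℕ j
    same-state : iter (step D) i′ s ≡ iter (step D) j′ s
    same-state = encode-injective _ _ (trans (sym (toℕ-fromℕ< _)) (trans (cong toℕ fi≡fj) (toℕ-fromℕ< _)))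
    returns : s ≡ iter (step D) (j′ ∸ i′) s
    returns = iter-injective V i′ s< (iter-inRange V (j′ ∸ i′) s<) (begin
      iter (step D) i′ s                          ≡⟨ same-state ⟩
      iter (step D) j′ s                          ≡⟨ cong (λ k → iter (step D) k s) (sym (m+[n∸m]≡n (<⇒≤ i<j))) ⟩
      iter (step D) (i′ + (j′ ∸ i′)) s            ≡⟨ iter-+ (step D) i′ (j′ ∸ i′) s ⟩
      iter (step D) i′ (iter (step D) (j′ ∸ i′) s) ∎)
      where open ≡-Reasoning

  reaches-sym : ∀ {s t} → InRange D s → Reaches D s t → Reaches D t s
  reaches-sym {s} {t} s< (j , e) = back (periodic s<)
    where
    back : (∃ λ p → 1 ≤ p × p ≤ 2 * size D × iter (step D) p s ≡ s) → Reaches D t s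
    back (p , 1≤p , _ , per) = j * p ∸ j , (begin
      iter (step D) (j * p ∸ j) t                      ≡⟨ cong (iter (step D) (j * p ∸ j)) (sym e) ⟩
      iter (step D) (j * p ∸ j) (iter (step D) j s)    ≡⟨ sym (iter-+ (step D) (j * p ∸ j) j s) ⟩
      iter (step D) (j * p ∸ j + j) s                  ≡⟨ cong (λ k → iter (step D) k s) (m∸n+n≡m j≤jp) ⟩
      iter (step D) (j * p) s                          ≡⟨ iter-* (step D) per j ⟩
      s                                                ∎)
      where
      open ≡-Reasoning
      j≤jp : j ≤ j * p
      j≤jp = ≤-trans (≤-reflexive (sym (*-identityʳ j))) (*-monoʳ-≤ j 1≤p)

  reaches-bounded : ∀ {s t} → InRange D s → Reaches D s t → ∃ λ k → k < 2 * size D × iter (step D) k s ≡ t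
  reaches-bounded {s} {t} s< (j , e) = shorten (periodic s<)
    where
    shorten : (∃ λ p → 1 ≤ p × p ≤ 2 * size D × iter (step D) p s ≡ s) → ∃ λ k → k < 2 * size D × iter (step D) k s ≡ t
    shorten (suc p , _ , p≤ , per) = j % suc p , <-≤-trans (m%n<n j (suc p)) p≤ , (begin
      iter (step D) (j % suc p) s                                   ≡⟨ cong (iter (step D) (j % suc p)) (sym (iter-* (step D) per (j / suc p))) ⟩
      iter (step D) (j % suc p) (iter (step D) (j / suc p * suc p) s) ≡⟨ sym (iter-+ (step D) (j % suc p) (j / suc p * suc p) s) ⟩
      iter (step D) (j % suc p + j / suc p * suc p) s               ≡⟨ cong (λ k → iter (step D) k s) (sym (m≡m%n+[m/n]*n j (suc p))) ⟩
      iter (step D) j s                                             ≡⟨ e ⟩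
      t                                                             ∎)
      where open ≡-Reasoning

-- Simulations

runUntil : (State → Bool) → (State → State) → ℕ → State → State
runUntil p f zero    s = s
runUntil p f (suc k) s = if p s then s else runUntil p f k (f s)

runUntil-stop : ∀ p f k {s} → p s ≡ true → runUntil p f k s ≡ s
runUntil-stop p f zero    _ = refl
runUntil-stop p f (suc k) e rewrite e = refl

runUntil-skip : ∀ p f k {s} → p s ≡ false → runUntil p f (suc k) s ≡ runUntil p f k (f s)
runUntil-skip p f k e rewrite e = refl

-- D′ is D with some edges removed.  States of D′ are embedded as the states of D
-- satisfying inImage; every state of D reaches the image within `detour` steps, and
-- the first return to the image after a step from embed x is embed (step D′ x).
record Simulation (D D′ : Diagram) : Set where
  field
    embed           : State → State
    retract         : State → State
    inImage         : State → Bool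
    detour          : ℕ
    embed-inRange   : ∀ {x} → InRange D′ x → InRange D (embed x)
    inImage-embed   : ∀ {x} → InRange D′ x → inImage (embed x) ≡ true
    retract-inRange : ∀ {s} → InRange D s → inImage s ≡ true → InRange D′ (retract s)
    retract-embed   : ∀ {x} → InRange D′ x → retract (embed x) ≡ x
    embed-retract   : ∀ {s} → InRange D s → inImage s ≡ true → embed (retract s) ≡ s
    returns         : ∀ {s} → InRange D s → inImage (runUntil inImage (step D) detour s) ≡ true
    return-step     : ∀ {x} → InRange D′ x → runUntil inImage (step D) detour (step D (embed x)) ≡ embed (step D′ x)

module _ {D D′ : Diagram} (V : Valid D) (V′ : Valid D′) (S : Simulation D D′) where
  open Simulation S

  private
    run : ℕ → State → State
    run = runUntil inImage (step D)

    run-suc : ∀ k s → inImage (run k s) ≡ true → run (suc k) s ≡ run k s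
    run-suc zero    s e rewrite e = refl
    run-suc (suc k) s e with inImage s
    ... | true  = refl
    ... | false = run-suc k (step D s) e

    run-skips : ∀ k {s} → inImage s ≡ false → inImage (run k s) ≡ true → run k (step D s) ≡ run k s
    run-skips zero    e h rewrite e = ⊥-elim (true≢false (sym h))
    run-skips (suc k) e h rewrite e = run-suc k _ h

    run-reaches : ∀ k s → Reaches D s (run k s)
    run-reaches zero    s = reaches-refl
    run-reaches (suc k) s with inImage s
    ... | true  = reaches-refl
    ... | false = reaches-trans {D} (reaches-step {D}) (run-reaches k (step D s))

    run-inRange : ∀ k {s} → InRange D s → InRange D (run k s)
    run-inRange zero    s< = s<
    run-inRange (suc k) {s} s< with inImage s
    ... | true  = s<
    ... | false = run-inRange k (step-inRange V {s} s<)

    project : State → State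
    project s = retract (run detour s)

    project-inRange : ∀ {s} → InRange D s → InRange D′ (project s)
    project-inRange s< = retract-inRange (run-inRange detour s<) (returns s<)

    embed-reaches-step : ∀ {x} → InRange D′ x → Reaches D (embed x) (embed (step D′ x))
    embed-reaches-step {x} x< =
      subst (Reaches D (embed x)) (return-step x<) (reaches-trans {D} (reaches-step {D}) (run-reaches detour _))

    embed-reaches : ∀ j {x} → InRange D′ x → Reaches D (embed x) (embed (iter (step D′) j x))
    embed-reaches zero    x< = reaches-refl
    embed-reaches (suc j) x< = reaches-trans {D} (embed-reaches j x<) (embed-reaches-step (iter-inRange V′ j x<))

  transfer : ∀ {L} → OrbitLabelling D′ L → OrbitLabelling D L
  transfer {L} lab = record
    { label         = λ s → label (project s)
    ; label<        = λ s< → label< (project-inRange s<)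
    ; label-step    = label-project-step
    ; label⇒reaches = project-reaches
    ; label-onto    = onto
    }
    where
    open OrbitLabelling lab
    label-project-step : ∀ {s} → InRange D s → label (project (step D s)) ≡ label (project s)
    label-project-step {s} s< with inImage s in eq
    ... | true = begin
      label (retract (run detour (step D s)))                       ≡⟨ cong (λ z → label (retract (run detour (step D z)))) (sym (embed-retract s< eq)) ⟩
      label (retract (run detour (step D (embed (retract s)))))     ≡⟨ cong (label ∘′ retract) (return-step (retract-inRange s< eq)) ⟩
      label (retract (embed (step D′ (retract s))))                 ≡⟨ cong label (retract-embed (step-inRange V′ {retract s} (retract-inRange s< eq))) ⟩
      label (step D′ (retract s))                                   ≡⟨ label-step (retract-inRange s< eq) ⟩
      label (retract s)                                             ≡⟨ cong (label ∘′ retract) (sym (runUntil-stop inImage (step D) detour eq)) ⟩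
      label (retract (run detour s))                                ∎
      where open ≡-Reasoning
    ... | false = cong (label ∘′ retract) (run-skips detour eq (returns s<))
    project-reaches : ∀ {s t} → InRange D s → InRange D t → label (project s) ≡ label (project t) → Reaches D s t
    project-reaches {s} {t} s< t< e with j , ej ← label⇒reaches (project-inRange s<) (project-inRange t<) e =
      reaches-trans {D} (run-reaches detour s) (reaches-trans {D} between (reaches-sym V t< (run-reaches detour t)))
      where
      between : Reaches D (run detour s) (run detour t)
      between = subst₂ (Reaches D) (embed-retract (run-inRange detour s<) (returns s<))
                                   (embed-retract (run-inRange detour t<) (returns t<))
                                   (subst (λ z → Reaches D (embed (project s)) (embed z)) ej (embed-reaches j (project-inRange s<)))
    onto : ∀ {l} → l < L → ∃ λ s → InRange D s × label (project s) ≡ l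
    onto l< with x , x< , ex ← label-onto l< =
      embed x , embed-inRange x< , trans (cong (label ∘′ retract) (runUntil-stop inImage (step D) detour (inImage-embed x<))) (trans (cong label (retract-embed x<)) ex)

-- Cyclic order, crossings and path labellings

-- cyclic x y z: going round in increasing direction from x one meets y before z.
cyclic : ℕ → ℕ → ℕ → Bool
cyclic x y z = ((x <ᵇ y) ∧ (y <ᵇ z)) ∨ (((y <ᵇ z) ∧ (z <ᵇ x)) ∨ ((z <ᵇ x) ∧ (x <ᵇ y)))

-- The edges at a and b cross iff exactly one end of b lies between a and its mate.
crosses : Diagram → ℕ → ℕ → Bool
crosses D a b = cyclic a b (mate D a) xor cyclic a (mate D b) (mate D a)

Adjacent : ℕ → ℕ → Set
Adjacent i j = j ≡ suc i ⊎ i ≡ suc j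

Adjacent-suc⁻ : ∀ {i j} → Adjacent (suc i) (suc j) → Adjacent i j
Adjacent-suc⁻ (inj₁ e) = inj₁ (suc-injective e)
Adjacent-suc⁻ (inj₂ e) = inj₂ (suc-injective e)

Adjacent-suc : ∀ {i j} → Adjacent i j → Adjacent (suc i) (suc j)
Adjacent-suc (inj₁ e) = inj₁ (cong suc e)
Adjacent-suc (inj₂ e) = inj₂ (cong suc e)

Adjacent-+ : ∀ k {i j} → Adjacent i j → Adjacent (k + i) (k + j)
Adjacent-+ zero    a = a
Adjacent-+ (suc k) a = Adjacent-suc (Adjacent-+ k a)

Adjacent-+⁻ : ∀ k {i j} → Adjacent (k + i) (k + j) → Adjacent i j
Adjacent-+⁻ zero    a = a
Adjacent-+⁻ (suc k) a = Adjacent-+⁻ k (Adjacent-suc⁻ a)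

-- The labels 0 … n - 1 of the edges identify the intersection graph with the path.
record PathLabelling (D : Diagram) (n : ℕ) (label : ℕ → ℕ) : Set where
  field
    valid            : Valid D
    size≡            : size D ≡ n + n
    label<           : ∀ {a} → a < size D → label a < n
    label-mate       : ∀ {a} → a < size D → label (mate D a) ≡ label a
    label-injective  : ∀ {a b} → a < size D → b < size D → label a ≡ label b → b ≡ a ⊎ b ≡ mate D a
    position         : ℕ → ℕ
    position<        : ∀ {i} → i < n → position i < size D
    label-position   : ∀ {i} → i < n → label (position i) ≡ i
    crosses⇒adjacent : ∀ {a b} → a < size D → b < size D → crosses D a b ≡ true → Adjacent (label a) (label b)
    adjacent⇒crosses : ∀ {a b} → a < size D → b < size D → Adjacent (label a) (label b) → crosses D a b ≡ true

TwistedBy : Diagram → (ℕ → ℕ) → (ℕ → Bool) → Set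
TwistedBy D label τ = ∀ {a} → a < size D → twisted D a ≡ τ (label a)

cyclic-rotate : ∀ x y z → cyclic x y z ≡ cyclic y z x
cyclic-rotate x y z with x <ᵇ y | y <ᵇ z | z <ᵇ x
... | true  | true  | true  = refl
... | true  | true  | false = refl
... | true  | false | true  = refl
... | true  | false | false = refl
... | false | true  | true  = refl
... | false | true  | false = refl
... | false | false | true  = refl
... | false | false | false = refl

cyclic-monotone : ∀ (f : ℕ → ℕ) → (∀ x y → (f x <ᵇ f y) ≡ (x <ᵇ y)) → ∀ x y z → cyclic (f x) (f y) (f z) ≡ cyclic x y z
cyclic-monotone f mono x y z rewrite mono x y | mono y z | mono z x = refl

private
  pred< : ∀ {n y} → suc y < n → y < n ∸ 1
  pred< {suc n} (s≤s p) = p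

  cyclic-last : ∀ {n y z} → suc y < n → suc z < n → cyclic (n ∸ 1) y z ≡ cyclic 0 (suc y) (suc z)
  cyclic-last {n} {y} {z} y< z< rewrite ≥⇒<ᵇ-false {n ∸ 1} {y} (<⇒≤ (pred< y<)) | <⇒<ᵇ-true (pred< z<) with y <ᵇ z
  ... | true  = refl
  ... | false = refl

  cyclic-last-last : ∀ {n z} → z < n → cyclic (n ∸ 1) (n ∸ 1) (prev n z) ≡ cyclic 0 0 z
  cyclic-last-last {n} {zero} z< rewrite ≥⇒<ᵇ-false {n ∸ 1} {n ∸ 1} ≤-refl = refl
  cyclic-last-last {n} {suc z} z< rewrite ≥⇒<ᵇ-false {n ∸ 1} {n ∸ 1} ≤-refl | ≥⇒<ᵇ-false {n ∸ 1} {z} (<⇒≤ (pred< z<)) | <⇒<ᵇ-true (pred< z<) = refl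

cyclic-prev : ∀ {n} x y z → x < n → y < n → z < n → cyclic (prev n x) (prev n y) (prev n z) ≡ cyclic x y z
cyclic-prev (suc x) (suc y) (suc z) _ _ _ = refl
cyclic-prev zero (suc y) (suc z) _ y< z< = cyclic-last y< z<
cyclic-prev {n} (suc x) zero (suc z) x< _ z< = trans (cyclic-rotate x (n ∸ 1) z) (trans (cyclic-last z< x<) (sym (cyclic-rotate (suc x) 0 (suc z))))
cyclic-prev {n} (suc x) (suc y) zero x< y< _ = trans (sym (cyclic-rotate (n ∸ 1) x y)) (trans (cyclic-last x< y<) (cyclic-rotate 0 (suc x) (suc y)))
cyclic-prev zero zero z _ _ z< = cyclic-last-last z<
cyclic-prev {n} zero (suc y) zero _ y< _ = trans (sym (cyclic-rotate (n ∸ 1) (n ∸ 1) y)) (trans (cyclic-last-last {n} {suc y} y<) (cyclic-rotate 0 (suc y) 0))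
cyclic-prev {n} (suc x) zero zero x< _ _ = trans (cyclic-rotate x (n ∸ 1) (n ∸ 1)) (trans (cyclic-last-last {n} {suc x} x<) (sym (cyclic-rotate (suc x) 0 0)))

cyclic-next : ∀ {n} x y z → x < n → y < n → z < n → cyclic (next n x) (next n y) (next n z) ≡ cyclic x y z
cyclic-next {n} x y z x< y< z< with cyclic-prev (next n x) (next n y) (next n z) (next< x<) (next< y<) (next< z<)
... | e rewrite prev-next x< | prev-next y< | prev-next z< = sym e

cyclic-from-0 : ∀ y z → y ≢ 0 → cyclic 0 y z ≡ (y <ᵇ z)
cyclic-from-0 zero    z y≢0 = ⊥-elim (y≢0 refl)
cyclic-from-0 (suc y) z _ with suc y <ᵇ z
... | true  = refl
... | false = refl

cyclic-above : ∀ {y z y′} → y < z → y′ < z → cyclic y z y′ ≡ (y′ <ᵇ y)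
cyclic-above {y} {z} {y′} y<z y′<z rewrite <⇒<ᵇ-true y<z | ≥⇒<ᵇ-false {z} {y′} (<⇒≤ y′<z) with y′ <ᵇ y
... | true  = refl
... | false = refl

cyclic-below : ∀ {y z y′} → z < y → z < y′ → cyclic y z y′ ≡ (y′ <ᵇ y)
cyclic-below {y} {z} {y′} z<y z<y′ rewrite ≥⇒<ᵇ-false {y} {z} (<⇒≤ z<y) | <⇒<ᵇ-true z<y′ with y′ <ᵇ y
... | true  = refl
... | false = refl

cyclic-increasing : ∀ {x y z} → x < y → y < z → cyclic x y z ≡ true
cyclic-increasing x<y y<z rewrite <⇒<ᵇ-true x<y | <⇒<ᵇ-true y<z = refl

crosses-below : ∀ D {y z} → y < z → mate D y < z → y < mate D z → mate D y < mate D z → crosses D y z ≡ false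
crosses-below D {y} y<z my<z y<mz my<mz = trans (cong₂ _xor_ (cyclic-above y<z my<z) (cyclic-above y<mz my<mz)) (xor-same (mate D y <ᵇ y))

crosses-above : ∀ D {y z} → z < y → z < mate D y → mate D z < y → mate D z < mate D y → crosses D y z ≡ false
crosses-above D {y} z<y z<my mz<y mz<my = trans (cong₂ _xor_ (cyclic-below z<y z<my) (cyclic-below mz<y mz<my)) (xor-same (mate D y <ᵇ y))

cyclic-repeat-start : ∀ x z → cyclic x x z ≡ false
cyclic-repeat-start x z rewrite ≥⇒<ᵇ-false {x} {x} ≤-refl with <-cmp x z
... | tri< x<z _ _ rewrite <⇒<ᵇ-true x<z | ≥⇒<ᵇ-false (<⇒≤ x<z) = refl
... | tri≈ _ refl _ rewrite ≥⇒<ᵇ-false {x} {x} ≤-refl = refl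
... | tri> _ _ z<x rewrite ≥⇒<ᵇ-false (<⇒≤ z<x) | <⇒<ᵇ-true z<x = refl

cyclic-repeat-end : ∀ x z → cyclic x z z ≡ false
cyclic-repeat-end x z rewrite ≥⇒<ᵇ-false {z} {z} ≤-refl with <-cmp x z
... | tri< x<z _ _ rewrite <⇒<ᵇ-true x<z | ≥⇒<ᵇ-false (<⇒≤ x<z) = refl
... | tri≈ _ refl _ rewrite ≥⇒<ᵇ-false {x} {x} ≤-refl = refl
... | tri> _ _ z<x rewrite ≥⇒<ᵇ-false (<⇒≤ z<x) | <⇒<ᵇ-true z<x = refl

-- Reindexing and rotation

record Reindexing (D : Diagram) (n : ℕ) : Set₁ where
  field
    old        : ℕ → ℕ
    new        : ℕ → ℕ
    Kept       : ℕ → Set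
    old<       : ∀ {a} → a < n → old a < size D
    old-kept   : ∀ {a} → a < n → Kept (old a)
    new<       : ∀ {b} → b < size D → Kept b → new b < n
    new-old    : ∀ {a} → a < n → new (old a) ≡ a
    old-new    : ∀ {b} → b < size D → Kept b → old (new b) ≡ b
    kept-mate  : ∀ {b} → b < size D → Kept b → Kept (mate D b)
    cyclic-old : ∀ {x y z} → x < n → y < n → z < n → cyclic (old x) (old y) (old z) ≡ cyclic x y z

module Reindexed {D : Diagram} (V : Valid D) {n : ℕ} (R : Reindexing D n) (tw : ℕ → Bool) where
  open Reindexing R
  open Valid V

  diagram′ : Diagram
  diagram′ = diagram n (λ a → new (mate D (old a))) tw

  mate-old< : ∀ {a} → a < n → mate D (old a) < size D
  mate-old< a< = mate< (old< a<)

  mate′< : ∀ {a} → a < n → mate diagram′ a < n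
  mate′< a< = new< (mate-old< a<) (kept-mate (old< a<) (old-kept a<))

  old-mate : ∀ {a} → a < n → old (mate diagram′ a) ≡ mate D (old a)
  old-mate a< = old-new (mate-old< a<) (kept-mate (old< a<) (old-kept a<))

  valid : (∀ {a} → a < n → tw (mate diagram′ a) ≡ tw a) → Valid diagram′
  valid tw-mate = record
    { mate<           = mate′<
    ; mate-involutive = λ {a} a< → trans (cong (λ b → new (mate D b)) (old-mate a<)) (trans (cong new (mate-involutive (old< a<))) (new-old a<))
    ; mate≢           = λ {a} a< e → mate≢ (old< a<) (trans (sym (old-mate a<)) (cong old e))
    ; twisted-mate    = tw-mate
    }

  crosses-old : ∀ {a b} → a < n → b < n → crosses diagram′ a b ≡ crosses D (old a) (old b)
  crosses-old {a} {b} a< b< = cong₂ _xor_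
    (trans (sym (cyclic-old a< b< (mate′< a<))) (cong (cyclic (old a) (old b)) (old-mate a<)))
    (trans (sym (cyclic-old a< (mate′< b<) (mate′< a<))) (cong₂ (cyclic (old a)) (old-mate b<) (old-mate a<)))

  pathLabelling : ∀ {k m label} → PathLabelling D (k + m) label → n ≡ m + m →
    (∀ {b} → b < size D → Kept b → k ≤ label b) → (∀ {b} → b < size D → k ≤ label b → Kept b) →
    Valid diagram′ → PathLabelling diagram′ m (λ a → label (old a) ∸ k)
  pathLabelling {k} {m} {label} G n≡ kept⇒ ⇒kept V′ = record
    { valid            = V′
    ; size≡            = n≡
    ; label<           = λ a< → subst (_ <_) (m+n∸m≡n k m) (∸-monoˡ-< (G.label< (old< a<)) (k≤ a<))
    ; label-mate       = λ a< → cong (_∸ k) (trans (cong label (old-mate a<)) (G.label-mate (old< a<)))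
    ; label-injective  = injective
    ; position         = λ i → new (G.position (k + i))
    ; position<        = λ i< → new< (G.position< (+-monoʳ-< k i<)) (kept-position i<)
    ; label-position   = λ {i} i< → trans (cong (λ b → label b ∸ k) (old-new (G.position< (+-monoʳ-< k i<)) (kept-position i<)))
                                          (trans (cong (_∸ k) (G.label-position (+-monoʳ-< k i<))) (m+n∸m≡n k i))
    ; crosses⇒adjacent = λ a< b< c → Adjacent-+⁻ k (subst₂ Adjacent (shift a<) (shift b<)
                                        (G.crosses⇒adjacent (old< a<) (old< b<) (trans (sym (crosses-old a< b<)) c)))
    ; adjacent⇒crosses = λ a< b< adj → trans (crosses-old a< b<)
                                        (G.adjacent⇒crosses (old< a<) (old< b<) (subst₂ Adjacent (sym (shift a<)) (sym (shift b<)) (Adjacent-+ k adj)))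
    }
    where
    module G = PathLabelling G
    k≤ : ∀ {a} → a < n → k ≤ label (old a)
    k≤ a< = kept⇒ (old< a<) (old-kept a<)
    shift : ∀ {a} → a < n → label (old a) ≡ k + (label (old a) ∸ k)
    shift a< = sym (m+[n∸m]≡n (k≤ a<))
    kept-position : ∀ {i} → i < m → Kept (G.position (k + i))
    kept-position {i} i< = ⇒kept (G.position< (+-monoʳ-< k i<)) (subst (k ≤_) (sym (G.label-position (+-monoʳ-< k i<))) (m≤m+n k i))
    injective : ∀ {a b} → a < n → b < n → label (old a) ∸ k ≡ label (old b) ∸ k → b ≡ a ⊎ b ≡ mate diagram′ a
    injective {a} {b} a< b< e with G.label-injective (old< a<) (old< b<) (∸-cancelʳ-≡ (k≤ a<) (k≤ b<) e)
    ... | inj₁ same = inj₁ (trans (sym (new-old b<)) (trans (cong new same) (new-old a<)))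
    ... | inj₂ mated = inj₂ (trans (sym (new-old b<)) (cong new mated))

module Rotation {D : Diagram} (V : Valid D) (old new : ℕ → ℕ)
  (old<      : ∀ {a} → a < size D → old a < size D)
  (new<      : ∀ {a} → a < size D → new a < size D)
  (new-old   : ∀ {a} → a < size D → new (old a) ≡ a)
  (old-new   : ∀ {a} → a < size D → old (new a) ≡ a)
  (old-next  : ∀ {a} → a < size D → old (next (size D) a) ≡ next (size D) (old a))
  (old-prev  : ∀ {a} → a < size D → old (prev (size D) a) ≡ prev (size D) (old a))
  (cyclic-old : ∀ {x y z} → x < size D → y < size D → z < size D → cyclic (old x) (old y) (old z) ≡ cyclic x y z)
  where
  open Valid V

  reindexing : Reindexing D (size D)
  reindexing = record
    { old = old ; new = new ; Kept = λ _ → ⊤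
    ; old< = old< ; old-kept = λ _ → tt ; new< = λ b< _ → new< b<
    ; new-old = new-old ; old-new = λ b< _ → old-new b< ; kept-mate = λ _ _ → tt
    ; cyclic-old = cyclic-old
    }

  open Reindexed V reindexing (twisted D ∘′ old) public using (diagram′)
  private
    module R = Reindexed V reindexing (twisted D ∘′ old)

  rotated-valid : Valid diagram′
  rotated-valid = R.valid λ a< → trans (cong (twisted D) (R.old-mate a<)) (twisted-mate (old< a<))

  simulation : Simulation D diagram′
  simulation = record
    { embed = λ s → old (proj₁ s) , proj₂ s ; retract = λ s → new (proj₁ s) , proj₂ s
    ; inImage = λ _ → true ; detour = 0
    ; embed-inRange = old< ; inImage-embed = λ _ → refl ; retract-inRange = λ b< _ → new< b<
    ; retract-embed = λ {x} x< → cong (_, proj₂ x) (new-old x<)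
    ; embed-retract = λ {s} s< _ → cong (_, proj₂ s) (old-new s<)
    ; returns = λ _ → refl
    ; return-step = λ {x} → commute {x}
    }
    where
    commute : ∀ {x} → InRange diagram′ x → step D (old (proj₁ x) , proj₂ x) ≡ (old (proj₁ (step diagram′ x)) , proj₂ (step diagram′ x))
    commute {a , d} a< with d xor twisted D (old a)
    ... | true  = cong (_, true)  (sym (trans (old-next (new< (mate< (old< a<)))) (cong (next (size D)) (old-new (mate< (old< a<))))))
    ... | false = cong (_, false) (sym (trans (old-prev (new< (mate< (old< a<)))) (cong (prev (size D)) (old-new (mate< (old< a<))))))

  rotate : ∀ {L} → OrbitLabelling diagram′ L → OrbitLabelling D L
  rotate = transfer V rotated-valid simulation

  rotated-pathLabelling : ∀ {m label} → PathLabelling D m label → PathLabelling diagram′ m (label ∘′ old)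
  rotated-pathLabelling G = R.pathLabelling {k = 0} G (PathLabelling.size≡ G) (λ _ _ → z≤n) (λ _ _ → tt) rotated-valid

  rotated-twistedBy : ∀ {label τ} → TwistedBy D label τ → TwistedBy diagram′ (label ∘′ old) τ
  rotated-twistedBy T a< = T (old< a<)

module RotateForward {D : Diagram} (V : Valid D) = Rotation V (next (size D)) (prev (size D)) next< prev< prev-next next-prev
  (λ _ → refl) (λ a< → trans (next-prev a<) (sym (prev-next a<))) (λ {x} {y} {z} → cyclic-next x y z)

module RotateBackward {D : Diagram} (V : Valid D) = Rotation V (prev (size D)) (next (size D)) prev< next< next-prev prev-next
  (λ a< → trans (prev-next a<) (sym (next-prev a<))) (λ _ → refl) (λ {x} {y} {z} → cyclic-prev x y z)

-- The continuant

-- The continuant over GF(2): the determinant of the tridiagonal matrix with diagonal t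
-- and all off-diagonal entries 1, i.e. of the adjacency matrix of the path plus diag t.
continuant : List Bool → Bool
continuant []          = true
continuant (t ∷ [])    = t
continuant (t ∷ u ∷ r) = (t ∧ continuant (u ∷ r)) xor continuant r

continuant-not : ∀ u r → continuant (not u ∷ r) ≡ continuant (u ∷ r) xor continuant r
continuant-not true  []      = refl
continuant-not false []      = refl
continuant-not u     (v ∷ r) with continuant (v ∷ r) | continuant r | u
... | true  | true  | true  = refl
... | true  | true  | false = refl
... | true  | false | true  = refl
... | true  | false | false = refl
... | false | true  | true  = refl
... | false | true  | false = refl
... | false | false | true  = refl
... | false | false | false = refl

-- Each boundary component is traced once in each direction: one face when the
-- continuant is 1, two faces otherwise.
faceOrbits : Bool → ℕ
faceOrbits true  = 2
faceOrbits false = 4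

OrbitsByContinuant : ℕ → Set
OrbitsByContinuant n = ∀ D label τ → PathLabelling D n label → TwistedBy D label τ →
  OrbitLabelling D (faceOrbits (continuant (applyUpTo τ n)))

-- Deleting a leaf

module LeafAt02Facts (M : ℕ) (mt : ℕ → ℕ) (tw : ℕ → Bool) (V : Valid (diagram (4 + M) mt tw)) (mt0 : mt 0 ≡ 2) where
  open Valid V

  D : Diagram
  D = diagram (4 + M) mt tw

  0< : 0 < 4 + M
  0< = s≤s z≤n
  1< : 1 < 4 + M
  1< = s≤s (s≤s z≤n)
  2< : 2 < 4 + M
  2< = s≤s (s≤s (s≤s z≤n))

  mt2 : mt 2 ≡ 0
  mt2 = trans (cong mt (sym mt0)) (mate-involutive 0<)

  tw2 : tw 2 ≡ tw 0
  tw2 = trans (cong tw (sym mt0)) (twisted-mate 0<)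

module TwistedLeaf (M : ℕ) (mt : ℕ → ℕ) (tw : ℕ → Bool) (V : Valid (diagram (4 + M) mt tw))
  (mt0 : mt 0 ≡ 2) (tw0 : tw 0 ≡ true) where
  open Valid V
  open LeafAt02Facts M mt tw V mt0 public

  data Kept : ℕ → Set where
    one    : Kept 1
    three+ : ∀ b → Kept (3 + b)

  old : ℕ → ℕ
  old zero    = 1
  old (suc a) = 3 + a

  new : ℕ → ℕ
  new (suc (suc (suc b))) = suc b
  new _                   = 0

  old-kept : ∀ a → Kept (old a)
  old-kept zero    = one
  old-kept (suc a) = three+ a

  old-new : ∀ {b} → Kept b → old (new b) ≡ b
  old-new one        = refl
  old-new (three+ b) = refl

  new-old : ∀ a → new (old a) ≡ a
  new-old zero    = refl
  new-old (suc a) = refl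

  old< : ∀ {a} → a < 2 + M → old a < 4 + M
  old< {zero}  _                = 1<
  old< {suc a} (s≤s (s≤s a<)) = s≤s (s≤s (s≤s (s≤s a<)))

  new< : ∀ {b} → b < 4 + M → Kept b → new b < 2 + M
  new< _                      one        = s≤s z≤n
  new< (s≤s (s≤s (s≤s b<))) (three+ b) = s≤s b<

  kept≢0 : ∀ {b} → Kept b → b ≢ 0
  kept≢0 one ()
  kept≢0 (three+ _) ()

  kept≢2 : ∀ {b} → Kept b → b ≢ 2
  kept≢2 one ()
  kept≢2 (three+ _) ()

  kept-mate : ∀ {b} → b < 4 + M → Kept b → Kept (mt b)
  kept-mate {b} b< kb with mt b in eq
  ... | zero              = ⊥-elim (kept≢2 kb (mate-injective b< 2< (trans eq (sym mt2))))
  ... | suc zero          = one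
  ... | suc (suc zero)    = ⊥-elim (kept≢0 kb (mate-injective b< 0< (trans eq (sym mt0))))
  ... | suc (suc (suc c)) = three+ c

  old-<ᵇ : ∀ x y → (old x <ᵇ old y) ≡ (x <ᵇ y)
  old-<ᵇ zero    zero    = refl
  old-<ᵇ zero    (suc y) = refl
  old-<ᵇ (suc x) zero    = refl
  old-<ᵇ (suc x) (suc y) = refl

  reindexing : Reindexing D (2 + M)
  reindexing = record
    { old = old ; new = new ; Kept = Kept
    ; old< = old< ; old-kept = λ {a} _ → old-kept a ; new< = new<
    ; new-old = λ {a} _ → new-old a ; old-new = λ _ → old-new ; kept-mate = kept-mate
    ; cyclic-old = λ {x} {y} {z} _ _ _ → cyclic-monotone old old-<ᵇ x y z
    }

  -- The edge at position 1, the neighbour of the leaf, receives an extra half-twist.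
  toggled : ℕ → Bool
  toggled b = (b ≡ᵇ 1) ∨ (b ≡ᵇ mt 1)

  module R = Reindexed V reindexing (λ a → tw (old a) xor toggled (old a))

  D′ : Diagram
  D′ = R.diagram′

  toggled-mate : ∀ {b} → b < 4 + M → toggled (mt b) ≡ toggled b
  toggled-mate {b} b< rewrite mate-≡ᵇ b< 1< | mate-≡ᵇ b< (mate< 1<) | mate-involutive 1< = ∨-comm (b ≡ᵇ mt 1) (b ≡ᵇ 1)

  valid′ : Valid D′
  valid′ = R.valid λ {a} a< → trans (cong (λ b → tw b xor toggled b) (R.old-mate a<))
                              (cong₂ _xor_ (twisted-mate (old< a<)) (toggled-mate (old< a<)))

  embed : State → State
  embed (zero  , d) = 1 , not d
  embed (suc a , d) = 3 + a , d

  retract : State → State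
  retract (suc zero , d)          = 0 , not d
  retract (suc (suc (suc b)) , d) = suc b , d
  retract (_ , d)                 = 0 , d

  inImage : State → Bool
  inImage (zero , _)           = false
  inImage (suc (suc zero) , _) = false
  inImage _                    = true

  step-0 : ∀ d → step D (0 , d) ≡ ((if d then 1 else 3) , not d)
  step-0 d rewrite tw0 | mt0 with d
  ... | true  = refl
  ... | false = refl

  step-2 : ∀ d → step D (2 , d) ≡ ((if d then 3 + M else 1) , not d)
  step-2 d rewrite tw2 | tw0 | mt2 with d
  ... | true  = refl
  ... | false = refl

  -- Leaving a kept position, at most one bounce off the leaf is needed to return.
  exit : ∀ p d → runUntil inImage (step D) 1 ((if d then next (4 + M) (3 + p) else prev (4 + M) (3 + p)) , d)
                 ≡ embed ((if d then next (2 + M) (suc p) else prev (2 + M) (suc p)) , d)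
  exit p true with p ≡ᵇ M
  ... | true  = step-0 true
  ... | false = refl
  exit zero    false = step-2 false
  exit (suc p) false = refl

  mate-three+ : ∀ {b} → b < 4 + M → Kept b → b ≢ mt 1 → ∃ λ p → mt b ≡ 3 + p
  mate-three+ {b} b< kb b≢ with mt b in eq | kept-mate b< kb
  ... | .1                 | one      = ⊥-elim (b≢ (trans (sym (mate-involutive b<)) (cong mt eq)))
  ... | .(3 + p)           | three+ p = p , refl

  private
    untoggle : ∀ d t → not d xor t ≡ d xor (t xor true)
    untoggle true  true  = refl
    untoggle true  false = refl
    untoggle false true  = refl
    untoggle false false = refl

    toggle : ∀ d t → d xor (t xor true) ≡ not (d xor t)
    toggle d t = trans (sym (untoggle d t)) (sym (not-distribˡ-xor d t))

  commute : ∀ {x} → InRange D′ x → runUntil inImage (step D) 1 (step D (embed x)) ≡ embed (step D′ x)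
  commute {zero , d} _ with mate-three+ 1< one (λ e → mate≢ 1< (sym e))
  ... | q , eq rewrite eq | untoggle d (tw 1) = exit q (d xor (tw 1 xor true))
  commute {suc a , d} a< with 3 + a ≟ mt 1
  ... | yes e rewrite ≡⇒≡ᵇ-true e | toggle d (tw (3 + a)) | trans (cong mt e) (mate-involutive 1<) with d xor tw (3 + a)
  ...   | true  = step-2 true
  ...   | false = step-0 false
  commute {suc a , d} a< | no ne with mate-three+ (old< {suc a} a<) (three+ a) ne
  ... | p , eq rewrite ≢⇒≡ᵇ-false ne | xor-identityʳ (tw (3 + a)) | eq = exit p (d xor tw (3 + a))

  hits : ∀ {s} → InRange D s → inImage (runUntil inImage (step D) 1 s) ≡ true
  hits {zero , d} _ rewrite step-0 d with d
  ... | true  = refl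
  ... | false = refl
  hits {suc zero , d} _ = refl
  hits {suc (suc zero) , d} _ rewrite step-2 d with d
  ... | true  = refl
  ... | false = refl
  hits {suc (suc (suc a)) , d} _ = refl

  simulation : Simulation D D′
  simulation = record
    { embed = embed ; retract = retract ; inImage = inImage ; detour = 1
    ; embed-inRange   = λ { {zero , d} _ → 1< ; {suc a , d} a< → old< {suc a} a< }
    ; inImage-embed   = λ { {zero , d} _ → refl ; {suc a , d} _ → refl }
    ; retract-inRange = λ { {suc zero , d} _ _ → s≤s z≤n ; {suc (suc (suc b)) , d} (s≤s (s≤s (s≤s b<))) _ → s≤s b< }
    ; retract-embed   = λ { {zero , d} _ → cong (0 ,_) (not-involutive d) ; {suc a , d} _ → refl }
    ; embed-retract   = λ { {suc zero , d} _ _ → cong (1 ,_) (not-involutive d) ; {suc (suc (suc b)) , d} _ _ → refl }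
    ; returns         = λ {s} → hits {s}
    ; return-step     = λ {x} → commute {x}
    }

  deleteLeaf : ∀ {L} → OrbitLabelling D′ L → OrbitLabelling D L
  deleteLeaf = transfer V valid′ simulation

module TwistedLeafPath (M : ℕ) (mt : ℕ → ℕ) (tw : ℕ → Bool) (n : ℕ) (lb : ℕ → ℕ) (τ : ℕ → Bool)
  (G : PathLabelling (diagram (4 + M) mt tw) (suc n) lb) (T : TwistedBy (diagram (4 + M) mt tw) lb τ)
  (mt0 : mt 0 ≡ 2) (lb0 : lb 0 ≡ 0) (lb1 : lb 1 ≡ 1) (tw0 : tw 0 ≡ true) where
  open PathLabelling G
  open Valid valid
  open TwistedLeaf M mt tw valid mt0 tw0

  kept⇒label≥1 : ∀ {b} → b < 4 + M → Kept b → 1 ≤ lb b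
  kept⇒label≥1 _  one        = ≤-reflexive (sym lb1)
  kept⇒label≥1 b< (three+ c) with lb (3 + c) in eq
  ... | suc _ = s≤s z≤n
  ... | zero with label-injective 0< b< (trans lb0 (sym eq))
  ...   | inj₂ b≡2 with () ← trans b≡2 mt0

  label≥1⇒kept : ∀ {b} → b < 4 + M → 1 ≤ lb b → Kept b
  label≥1⇒kept {zero}              _ l rewrite lb0 with () ← l
  label≥1⇒kept {suc zero}          _ _ = one
  label≥1⇒kept {suc (suc zero)}    _ l rewrite trans (cong lb (sym mt0)) (trans (label-mate 0<) lb0) with () ← l
  label≥1⇒kept {suc (suc (suc b))} _ _ = three+ b

  pathLabelling′ : PathLabelling D′ n (λ a → lb (old a) ∸ 1)
  pathLabelling′ = R.pathLabelling {k = 1} G (+-cancelˡ-≡ 2 _ _ (trans size≡ (cong suc (+-suc n n)))) kept⇒label≥1 label≥1⇒kept valid′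

  toggled-label : ∀ {b} → b < 4 + M → toggled b ≡ (lb b ≡ᵇ 1)
  toggled-label {b} b< with lb b ≟ 1
  ... | yes e with label-injective 1< b< (trans lb1 (sym e))
  ...   | inj₁ b≡1 rewrite b≡1 | e = refl
  ...   | inj₂ b≡q rewrite b≡q | e | ≡⇒≡ᵇ-true {mt 1} refl = ∨-zeroʳ (mt 1 ≡ᵇ 1)
  toggled-label {b} b< | no ne
    rewrite ≢⇒≡ᵇ-false ne | ≢⇒≡ᵇ-false {b} {1} (λ e → ne (trans (cong lb e) lb1))
          | ≢⇒≡ᵇ-false {b} {mt 1} (λ e → ne (trans (cong lb e) (trans (label-mate 1<) lb1))) = refl

  τ′ : ℕ → Bool
  τ′ zero    = not (τ 1)
  τ′ (suc i) = τ (2 + i)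

  twistedBy′ : TwistedBy D′ (λ a → lb (old a) ∸ 1) τ′
  twistedBy′ {a} a< = trans (cong₂ _xor_ (T (old< a<)) (toggled-label (old< a<))) (shifted (lb (old a)) (kept⇒label≥1 (old< a<) (old-kept a)))
    where
    shifted : ∀ x → 1 ≤ x → τ x xor (x ≡ᵇ 1) ≡ τ′ (x ∸ 1)
    shifted (suc zero)    _ = trans (xor-comm (τ 1) true) (true-xor (τ 1))
    shifted (suc (suc i)) _ = xor-identityʳ (τ (2 + i))

  τ0 : τ 0 ≡ true
  τ0 = trans (cong τ (sym lb0)) (trans (sym (T 0<)) tw0)

  continuant-τ′ : ∀ k → continuant (applyUpTo τ′ k) ≡ continuant (applyUpTo τ (suc k))
  continuant-τ′ zero    = sym τ0
  continuant-τ′ (suc k) rewrite τ0 = continuant-not (τ 1) (applyUpTo (λ i → τ (2 + i)) k)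

  reduce : OrbitsByContinuant n → OrbitLabelling D (faceOrbits (continuant (applyUpTo τ (suc n))))
  reduce IH = subst (OrbitLabelling D ∘′ faceOrbits) (continuant-τ′ n) (deleteLeaf (IH D′ _ τ′ pathLabelling′ twistedBy′))

-- From any kept position the boundary crosses the four deleted positions (the untwisted
-- leaf 0–2 and its neighbour 1–(4 + q)) within three steps.
module UntwistedLeaf (M q : ℕ) (mt : ℕ → ℕ) (tw : ℕ → Bool) (V : Valid (diagram (4 + M) mt tw))
  (mt0 : mt 0 ≡ 2) (tw0 : tw 0 ≡ false) (mt1 : mt 1 ≡ 4 + q) (q<M : 2 + q ≤ M) where
  open Valid V
  open LeafAt02Facts M mt tw V mt0 public

  mtq : mt (4 + q) ≡ 1
  mtq = trans (cong mt (sym mt1)) (mate-involutive 1<)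

  twq : tw (4 + q) ≡ tw 1
  twq = trans (cong tw (sym mt1)) (twisted-mate 1<)

  data Kept : ℕ → Set where
    kept : ∀ c → c ≢ suc q → Kept (3 + c)

  old : ℕ → ℕ
  old a = if a ≤ᵇ q then 3 + a else 4 + a

  new : ℕ → ℕ
  new (suc (suc (suc c))) = if c ≤ᵇ q then c else c ∸ 1
  new _                   = 0

  old-low : ∀ {a} → a ≤ q → old a ≡ 3 + a
  old-low a≤ rewrite ≤⇒≤ᵇ-true a≤ = refl

  old-high : ∀ {a} → q < a → old a ≡ 4 + a
  old-high q< rewrite >⇒≤ᵇ-false q< = refl

  new-low : ∀ {c} → c ≤ q → new (3 + c) ≡ c
  new-low c≤ rewrite ≤⇒≤ᵇ-true c≤ = refl

  new-high : ∀ {c} → q < c → new (3 + c) ≡ c ∸ 1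
  new-high q< rewrite >⇒≤ᵇ-false q< = refl

  new-old : ∀ a → new (old a) ≡ a
  new-old a with a ≤? q
  ... | yes a≤ rewrite old-low a≤ = new-low a≤
  ... | no a≰  rewrite old-high (≰⇒> a≰) = new-high {suc a} (m≤n⇒m≤1+n (≰⇒> a≰))

  old-new : ∀ {b} → Kept b → old (new b) ≡ b
  old-new (kept c c≢) with c ≤? q
  ... | yes c≤ rewrite new-low c≤ = old-low c≤
  old-new (kept zero    c≢) | no c≰ = ⊥-elim (c≰ z≤n)
  old-new (kept (suc c) c≢) | no c≰ rewrite new-high {suc c} (≰⇒> c≰) =
    old-high (≤∧≢⇒< (≤-pred (≰⇒> c≰)) λ e → c≢ (cong suc (sym e)))

  old-kept : ∀ a → Kept (old a)
  old-kept a with a ≤? q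
  ... | yes a≤ rewrite old-low a≤ = kept a λ e → <-irrefl refl (subst (_≤ q) e a≤)
  ... | no a≰  rewrite old-high (≰⇒> a≰) = kept (suc a) λ e → <-irrefl (suc-injective (sym e)) (≰⇒> a≰)

  old< : ∀ {a} → a < M → old a < 4 + M
  old< {a} a< with a ≤? q
  ... | yes a≤ rewrite old-low a≤ = s≤s (s≤s (s≤s (m≤n⇒m≤1+n a<)))
  ... | no a≰  rewrite old-high (≰⇒> a≰) = s≤s (s≤s (s≤s (s≤s a<)))

  new< : ∀ {b} → b < 4 + M → Kept b → new b < M
  new< b< (kept c c≢) with c ≤? q
  ... | yes c≤ rewrite new-low c≤ = ≤-trans (s≤s c≤) (≤-trans (n≤1+n (suc q)) q<M)
  new< b< (kept zero    c≢) | no c≰ = ⊥-elim (c≰ z≤n)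
  new< b< (kept (suc c) c≢) | no c≰ rewrite new-high {suc c} (≰⇒> c≰) = ≤-pred (≤-pred (≤-pred (≤-pred b<)))

  kept-mate : ∀ {b} → b < 4 + M → Kept b → Kept (mt b)
  kept-mate {b} b< (kept c c≢) with mt (3 + c) in eq
  ... | zero = case mate-injective b< 2< (trans eq (sym mt2)) of λ ()
  ... | suc zero = ⊥-elim (c≢ (cong (_∸ 3) (trans (mate-injective b< (mate< 1<) (trans eq (sym (mate-involutive 1<)))) mt1)))
  ... | suc (suc zero) = case mate-injective b< 0< (trans eq (sym mt0)) of λ ()
  ... | suc (suc (suc c′)) with c′ ≟ suc q
  ...   | no c′≢ = kept c′ c′≢
  ...   | yes e  = case mate-injective b< 1< (trans eq (trans (cong (3 +_) e) (sym mt1))) of λ ()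

  old-<ᵇ : ∀ x y → (old x <ᵇ old y) ≡ (x <ᵇ y)
  old-<ᵇ x y with x ≤? q | y ≤? q
  ... | yes x≤ | yes y≤ rewrite old-low x≤ | old-low y≤ = refl
  ... | no x≰  | no y≰  rewrite old-high (≰⇒> x≰) | old-high (≰⇒> y≰) = refl
  ... | yes x≤ | no y≰  rewrite old-low x≤ | old-high (≰⇒> y≰)
    | <⇒<ᵇ-true {x} {y} (≤-<-trans x≤ (≰⇒> y≰)) | <⇒<ᵇ-true {x} {suc y} (m<n⇒m<1+n (≤-<-trans x≤ (≰⇒> y≰))) = refl
  ... | no x≰  | yes y≤ rewrite old-high (≰⇒> x≰) | old-low y≤
    | ≥⇒<ᵇ-false {x} {y} (≤-trans y≤ (<⇒≤ (≰⇒> x≰))) | ≥⇒<ᵇ-false {suc x} {y} (m≤n⇒m≤1+n (≤-trans y≤ (<⇒≤ (≰⇒> x≰)))) = refl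

  reindexing : Reindexing D M
  reindexing = record
    { old = old ; new = new ; Kept = Kept
    ; old< = old< ; old-kept = λ {a} _ → old-kept a ; new< = new<
    ; new-old = λ {a} _ → new-old a ; old-new = λ _ → old-new ; kept-mate = kept-mate
    ; cyclic-old = λ {x} {y} {z} _ _ _ → cyclic-monotone old old-<ᵇ x y z
    }

  module R = Reindexed V reindexing (tw ∘′ old)

  D′ : Diagram
  D′ = R.diagram′

  valid′ : Valid D′
  valid′ = R.valid λ a< → trans (cong tw (R.old-mate a<)) (twisted-mate (old< a<))

  inImage : State → Bool
  inImage (suc (suc (suc c)) , _) = not (c ≡ᵇ suc q)
  inImage _                       = false

  inImage-kept : ∀ {b d} → Kept b → inImage (b , d) ≡ true
  inImage-kept (kept c c≢) rewrite ≢⇒≡ᵇ-false c≢ = refl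

  kept-inImage : ∀ {b d} → inImage (b , d) ≡ true → Kept b
  kept-inImage {suc (suc (suc c))} e with c ≟ suc q
  ... | no c≢ = kept c c≢
  ... | yes c≡ rewrite ≡⇒≡ᵇ-true c≡ with () ← e

  private
    run : ℕ → State → State
    run = runUntil inImage (step D)

    skip : ∀ k s {s′} → inImage s ≡ false → step D s ≡ s′ → run (suc k) s ≡ run k s′
    skip k s out e = trans (runUntil-skip inImage (step D) k out) (cong (run k) e)

    stop : ∀ k {s} → inImage s ≡ true → run k s ≡ s
    stop = runUntil-stop inImage (step D)

    q≢sq : q ≢ suc q
    q≢sq e = <-irrefl e (n<1+n q)

    sq≢M : suc q ≢ M
    sq≢M e = <-irrefl e q<M

  step-0-true : step D (0 , true) ≡ (3 , true)
  step-0-true rewrite tw0 | mt0 = refl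
  step-0-false : step D (0 , false) ≡ (1 , false)
  step-0-false rewrite tw0 | mt0 = refl
  step-2-true : step D (2 , true) ≡ (1 , true)
  step-2-true rewrite tw2 | tw0 | mt2 = refl
  step-2-false : step D (2 , false) ≡ (3 + M , false)
  step-2-false rewrite tw2 | tw0 | mt2 = refl

  step-1 : ∀ d t → tw 1 ≡ t → step D (1 , d) ≡ ((if d xor t then 5 + q else 3 + q) , d xor t)
  step-1 d t e rewrite mt1 | ≢⇒≡ᵇ-false sq≢M | e = refl

  step-q : ∀ d t → tw 1 ≡ t → step D (4 + q , d) ≡ ((if d xor t then 2 else 0) , d xor t)
  step-q d t e rewrite mtq | twq | e = refl

  out-q : ∀ d → inImage (4 + q , d) ≡ false
  out-q d = cong not (≡⇒≡ᵇ-true {suc q} refl)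

  in-3q : ∀ d → inImage (3 + q , d) ≡ true
  in-3q d rewrite ≢⇒≡ᵇ-false q≢sq = refl

  in-5q : ∀ d → inImage (5 + q , d) ≡ true
  in-5q d rewrite ≢⇒≡ᵇ-false {suc (suc q)} {suc q} (λ e → q≢sq (sym (suc-injective e))) = refl

  run-q-true : run 3 (4 + q , true) ≡ (5 + q , true)
  run-q-true with tw 1 in t
  ... | true  = trans (skip 2 (4 + q , true) (out-q true) (step-q true true t))
               (trans (skip 1 (0 , false) refl step-0-false) (skip 0 (1 , false) refl (step-1 false true t)))
  ... | false = trans (skip 2 (4 + q , true) (out-q true) (step-q true false t))
               (trans (skip 1 (2 , true) refl step-2-true) (skip 0 (1 , true) refl (step-1 true false t)))

  run-q-false : run 3 (4 + q , false) ≡ (3 + q , false)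
  run-q-false with tw 1 in t
  ... | true  = trans (skip 2 (4 + q , false) (out-q false) (step-q false true t))
               (trans (skip 1 (2 , true) refl step-2-true) (skip 0 (1 , true) refl (step-1 true true t)))
  ... | false = trans (skip 2 (4 + q , false) (out-q false) (step-q false false t))
               (trans (skip 1 (0 , false) refl step-0-false) (skip 0 (1 , false) refl (step-1 false false t)))

  run-0-true : run 3 (0 , true) ≡ (3 , true)
  run-0-true = trans (skip 2 (0 , true) refl step-0-true) (stop 2 refl)

  run-2-false : run 3 (2 , false) ≡ (3 + M , false)
  run-2-false = trans (skip 2 (2 , false) refl step-2-false) (stop 2 (cong not (≢⇒≡ᵇ-false (λ e → sq≢M (sym e)))))

  embed : State → State
  embed (a , d) = old a , d

  retract : State → State
  retract (b , d) = new b , d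

  private
    suc-pred-M : suc (M ∸ 1) ≡ M
    suc-pred-M = m+[n∸m]≡n {1} {M} (≤-trans (s≤s z≤n) q<M)

  exit-up : ∀ p → p < M → run 3 (next (4 + M) (old p) , true) ≡ embed (next M p , true)
  exit-up p p< with <-cmp p q
  ... | tri< p<q _ _ rewrite old-low (<⇒≤ p<q) | ≢⇒≡ᵇ-false {p} {M} (λ e → <-irrefl e p<)
        | ≢⇒≡ᵇ-false {suc p} {M} (λ e → <-irrefl e (≤-trans (s≤s p<q) (≤-trans (n≤1+n (suc q)) q<M))) | old-low p<q
        | ≢⇒≡ᵇ-false {p} {q} (λ e → <-irrefl e p<q) = refl
  ... | tri≈ _ refl _ rewrite old-low {p} ≤-refl | ≢⇒≡ᵇ-false {p} {M} (λ e → <-irrefl e p<) | ≢⇒≡ᵇ-false sq≢M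
        | old-high {suc p} (n<1+n p) = run-q-true
  ... | tri> _ _ q<p with suc p ≟ M
  ...   | yes e rewrite old-high q<p | ≡⇒≡ᵇ-true e | old-low {0} z≤n = run-0-true
  ...   | no ne rewrite old-high q<p | ≢⇒≡ᵇ-false ne | old-high {suc p} (m<n⇒m<1+n q<p)
          | ≢⇒≡ᵇ-false {suc p} {q} (λ e → <-irrefl (sym e) (m<n⇒m<1+n q<p)) = refl

  exit-down : ∀ p → p < M → run 3 (prev (4 + M) (old p) , false) ≡ embed (prev M p , false)
  exit-down zero _ rewrite old-low {0} z≤n | old-high {M ∸ 1} (≤-pred (≤-trans q<M (≤-reflexive (sym suc-pred-M)))) | suc-pred-M = run-2-false
  exit-down (suc p) _ with <-cmp p q
  ... | tri< p<q _ _ rewrite old-low {suc p} p<q | old-low {p} (<⇒≤ p<q)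
        | ≢⇒≡ᵇ-false {p} {suc q} (λ e → <-irrefl e (m<n⇒m<1+n p<q)) = refl
  ... | tri≈ _ refl _ rewrite old-high {suc p} (n<1+n p) | old-low {p} ≤-refl = run-q-false
  ... | tri> _ _ q<p rewrite old-high {suc p} (m<n⇒m<1+n q<p) | old-high q<p
        | ≢⇒≡ᵇ-false {p} {q} (λ e → <-irrefl (sym e) q<p) = refl

  commute : ∀ {x} → InRange D′ x → run 3 (step D (embed x)) ≡ embed (step D′ x)
  commute {a , d} a< with d xor tw (old a)
  ... | true  = trans (cong (λ b → run 3 (next (4 + M) b , true)) (sym (old-new k))) (exit-up _ (new< (mate< (old< a<)) k))
    where
    k = kept-mate (old< a<) (old-kept a)
  ... | false = trans (cong (λ b → run 3 (prev (4 + M) b , false)) (sym (old-new k))) (exit-down _ (new< (mate< (old< a<)) k))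
    where
    k = kept-mate (old< a<) (old-kept a)

  leaves-1 : ∀ k d → inImage (run k (step D (1 , d))) ≡ true
  leaves-1 k d rewrite step-1 d (tw 1) refl with d xor tw 1
  ... | true  = trans (cong inImage (stop k (in-5q true))) (in-5q true)
  ... | false = trans (cong inImage (stop k (in-3q false))) (in-3q false)

  hits : ∀ {s} → InRange D s → inImage (run 3 s) ≡ true
  hits {zero , true}  _ = cong inImage run-0-true
  hits {zero , false} _ = trans (cong inImage (trans (skip 2 (0 , false) refl step-0-false) (skip 1 (1 , false) refl refl))) (leaves-1 1 false)
  hits {suc zero , d} _ = leaves-1 2 d
  hits {suc (suc zero) , true}  _ = trans (cong inImage (trans (skip 2 (2 , true) refl step-2-true) (skip 1 (1 , true) refl refl))) (leaves-1 1 true)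
  hits {suc (suc zero) , false} _ = trans (cong inImage run-2-false) (cong not (≢⇒≡ᵇ-false (λ e → sq≢M (sym e))))
  hits {suc (suc (suc c)) , d} _ with c ≟ suc q
  ... | yes refl = via-q d
    where
    via-q : ∀ d → inImage (run 3 (4 + q , d)) ≡ true
    via-q true  = trans (cong inImage run-q-true) (in-5q true)
    via-q false = trans (cong inImage run-q-false) (in-3q false)
  ... | no c≢ = trans (cong inImage (stop 3 {3 + c , d} (inImage-kept {d = d} (kept c c≢)))) (inImage-kept {d = d} (kept c c≢))

  simulation : Simulation D D′
  simulation = record
    { embed = embed ; retract = retract ; inImage = inImage ; detour = 3
    ; embed-inRange   = old<
    ; inImage-embed   = λ {x} _ → inImage-kept {d = proj₂ x} (old-kept (proj₁ x))
    ; retract-inRange = λ {s} s< e → new< s< (kept-inImage {proj₁ s} {proj₂ s} e)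
    ; retract-embed   = λ {x} _ → cong (_, proj₂ x) (new-old (proj₁ x))
    ; embed-retract   = λ {s} _ e → cong (_, proj₂ s) (old-new (kept-inImage {proj₁ s} {proj₂ s} e))
    ; returns         = λ {s} → hits {s}
    ; return-step     = λ {x} → commute {x}
    }

  deleteLeaf : ∀ {L} → OrbitLabelling D′ L → OrbitLabelling D L
  deleteLeaf = transfer V valid′ simulation

module UntwistedLeafPath (M q : ℕ) (mt : ℕ → ℕ) (tw : ℕ → Bool) (n : ℕ) (lb : ℕ → ℕ) (τ : ℕ → Bool)
  (G : PathLabelling (diagram (4 + M) mt tw) (2 + n) lb) (T : TwistedBy (diagram (4 + M) mt tw) lb τ)
  (mt0 : mt 0 ≡ 2) (tw0 : tw 0 ≡ false) (mt1 : mt 1 ≡ 4 + q) (q<M : 2 + q ≤ M) (lb0 : lb 0 ≡ 0) (lb1 : lb 1 ≡ 1) where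
  open PathLabelling G
  open Valid valid
  open UntwistedLeaf M q mt tw valid mt0 tw0 mt1 q<M

  kept⇒label≥2 : ∀ {b} → b < 4 + M → Kept b → 2 ≤ lb b
  kept⇒label≥2 {b} b< (kept c c≢) with lb b in eq
  ... | suc (suc _) = s≤s (s≤s z≤n)
  ... | zero with label-injective 0< b< (trans lb0 (sym eq))
  ...   | inj₂ b≡2 with () ← trans b≡2 mt0
  kept⇒label≥2 {b} b< (kept c c≢) | suc zero with label-injective 1< b< (trans lb1 (sym eq))
  ...   | inj₂ b≡q = ⊥-elim (c≢ (cong (_∸ 3) (trans b≡q mt1)))

  label≥2⇒kept : ∀ {b} → b < 4 + M → 2 ≤ lb b → Kept b
  label≥2⇒kept {zero}           _ l rewrite lb0 with () ← l
  label≥2⇒kept {suc zero}       _ l rewrite lb1 with s≤s () ← l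
  label≥2⇒kept {suc (suc zero)} _ l rewrite trans (cong lb (sym mt0)) (trans (label-mate 0<) lb0) with () ← l
  label≥2⇒kept {suc (suc (suc c))} _ l with c ≟ suc q
  ... | no c≢ = kept c c≢
  ... | yes refl rewrite trans (cong lb (sym mt1)) (trans (label-mate 1<) lb1) with s≤s () ← l

  pathLabelling′ : PathLabelling D′ n (λ a → lb (old a) ∸ 2)
  pathLabelling′ = R.pathLabelling {k = 2} G size′ kept⇒label≥2 label≥2⇒kept valid′
    where
    size′ : M ≡ n + n
    size′ = +-cancelˡ-≡ 4 _ _ (trans size≡ (cong (2 +_) (trans (+-suc n (suc n)) (cong suc (+-suc n n)))))

  twistedBy′ : TwistedBy D′ (λ a → lb (old a) ∸ 2) (λ i → τ (2 + i))
  twistedBy′ {a} a< = trans (T (old< a<)) (cong τ (sym (m+[n∸m]≡n (kept⇒label≥2 (old< a<) (old-kept a)))))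

  τ0 : τ 0 ≡ false
  τ0 = trans (cong τ (sym lb0)) (trans (sym (T 0<)) tw0)

  reduce : OrbitsByContinuant n → OrbitLabelling D (faceOrbits (continuant (applyUpTo τ (2 + n))))
  reduce IH rewrite τ0 = deleteLeaf (IH D′ _ (λ i → τ (2 + i)) pathLabelling′ twistedBy′)

-- Locating the leaf

-- The edge at position 0 is a leaf of the path.  Every other edge it does not cross
-- lies on one side of it, and those with labels ≥ 2 form a connected subpath, so all
-- lie on the same side; the other side then holds exactly one end of the edge labelled 1.
module LeafPosition (M : ℕ) (mt : ℕ → ℕ) (tw : ℕ → Bool) (n : ℕ) (lb : ℕ → ℕ)
  (G : PathLabelling (diagram (4 + M) mt tw) n lb) (lb0 : lb 0 ≡ 0) where
  open PathLabelling G
  open Valid valid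

  D : Diagram
  D = diagram (4 + M) mt tw

  0< : 0 < 4 + M
  0< = s≤s z≤n

  inside : ℕ → Bool
  inside y = y <ᵇ mt 0

  label-mt0 : lb (mt 0) ≡ 0
  label-mt0 = trans (label-mate 0<) lb0

  label≢0⇒≢0 : ∀ {y} → lb y ≢ 0 → y ≢ 0
  label≢0⇒≢0 ne e = ne (trans (cong lb e) lb0)

  label≢0⇒≢mt0 : ∀ {y} → lb y ≢ 0 → y ≢ mt 0
  label≢0⇒≢mt0 ne e = ne (trans (cong lb e) label-mt0)

  mate-label≢0 : ∀ {y} → y < 4 + M → lb y ≢ 0 → lb (mt y) ≢ 0
  mate-label≢0 y< ne e = ne (trans (sym (label-mate y<)) e)

  crosses-0 : ∀ {y} → y < 4 + M → lb y ≢ 0 → crosses D 0 y ≡ (inside y xor inside (mt y))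
  crosses-0 y< ne = cong₂ _xor_ (cyclic-from-0 _ (mt 0) (label≢0⇒≢0 ne)) (cyclic-from-0 _ (mt 0) (label≢0⇒≢0 (mate-label≢0 y< ne)))

  inside-true : ∀ {y} → inside y ≡ true → y < mt 0
  inside-true = <ᵇ-true⇒<

  inside-false : ∀ {y} → inside y ≡ false → lb y ≢ 0 → mt 0 < y
  inside-false e ne = ≤∧≢⇒< (<ᵇ-false⇒≥ e) (λ eq → label≢0⇒≢mt0 ne (sym eq))

  straddles : ∀ {y} → y < 4 + M → lb y ≡ 1 → (inside y xor inside (mt y)) ≡ true
  straddles y< e = trans (sym (crosses-0 y< λ e0 → case trans (sym e) e0 of λ ())) (adjacent⇒crosses 0< y< (inj₁ (trans e (cong suc (sym lb0)))))

  label≥2⇒≢0 : ∀ {y} → 2 ≤ lb y → lb y ≢ 0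
  label≥2⇒≢0 l e rewrite e with () ← l

  one-side : ∀ {y} → y < 4 + M → 2 ≤ lb y → inside y ≡ inside (mt y)
  one-side {y} y< l with crosses D 0 y in c
  ... | true with crosses⇒adjacent 0< y< c
  ...   | inj₁ e with s≤s () ← subst (2 ≤_) (trans e (cong suc lb0)) l
  ...   | inj₂ e with () ← trans (sym lb0) e
  one-side {y} y< l | false = xor-false (trans (sym (crosses-0 y< (label≥2⇒≢0 l))) c)
    where
    xor-false : ∀ {a b} → a xor b ≡ false → a ≡ b
    xor-false {true}  {true}  _ = refl
    xor-false {false} {false} _ = refl

  label1-unique : ∀ {y} → y < 4 + M → lb y ≡ 1 → inside y ≢ inside (mt y)
  label1-unique {y} y< e same = true≢false (trans (sym (straddles y< e)) (trans (cong (_xor inside (mt y)) same) (xor-same (inside (mt y)))))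

  same-side : ∀ {y z} → y < 4 + M → z < 4 + M → 2 ≤ lb y → 2 ≤ lb z → Adjacent (lb y) (lb z) → inside y ≡ inside z
  same-side {y} {z} y< z< ly lz adj with inside y in iy | inside z in iz
  ... | true  | true  = refl
  ... | false | false = refl
  ... | true  | false = ⊥-elim (true≢false (trans (sym (adjacent⇒crosses y< z< adj)) (crosses-below D
          (<-trans (inside-true iy) (inside-false iz nz)) (<-trans (inside-true iy′) (inside-false iz nz))
          (<-trans (inside-true iy) (inside-false iz′ nz′)) (<-trans (inside-true iy′) (inside-false iz′ nz′)))))
    where
    iy′ = trans (sym (one-side y< ly)) iy
    iz′ = trans (sym (one-side z< lz)) iz
    nz  = label≥2⇒≢0 lz
    nz′ = mate-label≢0 z< nz
  ... | false | true = ⊥-elim (true≢false (trans (sym (adjacent⇒crosses y< z< adj)) (crosses-above D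
          (<-trans (inside-true iz) (inside-false iy ny)) (<-trans (inside-true iz) (inside-false iy′ ny′))
          (<-trans (inside-true iz′) (inside-false iy ny)) (<-trans (inside-true iz′) (inside-false iy′ ny′)))))
    where
    iy′ = trans (sym (one-side y< ly)) iy
    iz′ = trans (sym (one-side z< lz)) iz
    ny  = label≥2⇒≢0 ly
    ny′ = mate-label≢0 y< ny

  side : Bool
  side = inside (position 2)

  position-side : ∀ k → 2 + k < n → inside (position (2 + k)) ≡ side
  position-side zero    _  = refl
  position-side (suc k) k< = trans (sym (same-side (position< k<′) (position< k<) (label≥ k<′) (label≥ k<) adj)) (position-side k k<′)
    where
    k<′ = <-trans (n<1+n (2 + k)) k<
    label≥ : ∀ {j} → 2 + j < n → 2 ≤ lb (position (2 + j))
    label≥ {j} j< = subst (2 ≤_) (sym (label-position j<)) (s≤s (s≤s z≤n))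
    adj = inj₁ (trans (label-position k<) (cong suc (sym (label-position k<′))))

  label≥2-side : ∀ {y} → y < 4 + M → 2 ≤ lb y → inside y ≡ side
  label≥2-side {y} y< l = at (lb y) refl l (label< y<)
    where
    at : ∀ j → lb y ≡ j → 2 ≤ j → j < n → inside y ≡ side
    at (suc zero) _ (s≤s ()) _
    at (suc (suc k)) e _ k< with label-injective (position< k<) y< (trans (label-position k<) (sym e))
    ... | inj₁ y≡p = trans (cong inside y≡p) (position-side k k<)
    ... | inj₂ y≡m = trans (cong inside y≡m)
           (trans (sym (one-side (position< k<) (subst (2 ≤_) (sym (label-position k<)) (s≤s (s≤s z≤n))))) (position-side k k<))

  label1-twice : ∀ {y z} → y < 4 + M → z < 4 + M → y ≢ z → lb y ≡ 1 → lb z ≡ 1 → inside y ≢ inside z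
  label1-twice {y} {z} y< z< y≢z ly lz same with label-injective y< z< (trans ly (sym lz))
  ... | inj₁ z≡y = y≢z (sym z≡y)
  ... | inj₂ z≡m = label1-unique y< ly (trans same (cong inside z≡m))

  other-side : ∀ {y} → y < 4 + M → y ≢ 0 → y ≢ mt 0 → inside y ≢ side → lb y ≡ 1
  other-side {y} y< y≢0 y≢m ne with lb y in e
  ... | suc zero = refl
  ... | suc (suc _) = ⊥-elim (ne (label≥2-side y< (subst (2 ≤_) (sym e) (s≤s (s≤s z≤n)))))
  ... | zero with label-injective 0< y< (trans lb0 (sym e))
  ...   | inj₁ y≡0 = ⊥-elim (y≢0 y≡0)
  ...   | inj₂ y≡m = ⊥-elim (y≢m y≡m)

  inner⇒label1 : side ≡ false → ∀ {y} → y < 4 + M → y ≢ 0 → y < mt 0 → lb y ≡ 1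
  inner⇒label1 s y< y≢0 y<m = other-side y< y≢0 (λ e → <-irrefl e y<m) (λ i → true≢false (trans (sym (<⇒<ᵇ-true y<m)) (trans i s)))

  outer⇒label1 : side ≡ true → ∀ {y} → y < 4 + M → mt 0 < y → lb y ≡ 1
  outer⇒label1 s y< m<y = other-side y< (λ e → <-irrefl (sym e) (≤-<-trans z≤n m<y)) (λ e → <-irrefl (sym e) m<y)
                            (λ i → true≢false (trans (sym s) (trans (sym i) (≥⇒<ᵇ-false (<⇒≤ m<y)))))

  module _ (n≥2 : 2 ≤ n) where

    private
      u< : position 1 < 4 + M
      u< = position< n≥2
      label-u : lb (position 1) ≡ 1
      label-u = label-position n≥2
      label-u≢0 : lb (position 1) ≢ 0
      label-u≢0 e with () ← trans (sym label-u) e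
      1< : 1 < 4 + M
      1< = s≤s (s≤s z≤n)
      2< : 2 < 4 + M
      2< = s≤s (s≤s (s≤s z≤n))
      last< : 3 + M < 4 + M
      last< = ≤-refl
      last′< : 2 + M < 4 + M
      last′< = m<n⇒m<1+n ≤-refl

    mt0≢1 : mt 0 ≢ 1
    mt0≢1 m≡1 = label1-unique u< label-u (trans (outer (label≢0⇒≢0 label-u≢0)) (sym (outer (label≢0⇒≢0 (mate-label≢0 u< label-u≢0)))))
      where
      outer : ∀ {y} → y ≢ 0 → inside y ≡ false
      outer y≢0 rewrite m≡1 = ≥⇒<ᵇ-false (n≢0⇒n>0 y≢0)

    mt0≢last : mt 0 ≢ 3 + M
    mt0≢last m≡ = label1-unique u< label-u (trans (inner u< (label≢0⇒≢mt0 label-u≢0)) (sym (inner (mate< u<) (label≢0⇒≢mt0 (mate-label≢0 u< label-u≢0)))))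
      where
      inner : ∀ {y} → y < 4 + M → y ≢ mt 0 → inside y ≡ true
      inner y< y≢m = <⇒<ᵇ-true (≤∧≢⇒< (subst (_ ≤_) (sym m≡) (≤-pred y<)) y≢m)

    leaf-short : side ≡ false → mt 0 ≡ 2 × lb 1 ≡ 1
    leaf-short s with <-cmp (mt 0) 2
    ... | tri≈ _ m≡2 _ = m≡2 , inner⇒label1 s 1< (λ ()) (subst (1 <_) (sym m≡2) (s≤s (s≤s z≤n)))
    ... | tri< m<2 _ _ = ⊥-elim (mt0≢1 (≤-antisym (≤-pred m<2) (n≢0⇒n>0 (mate≢ 0<))))
    ... | tri> _ _ 2<m = ⊥-elim (label1-twice 1< 2< (λ ()) (inner⇒label1 s 1< (λ ()) 1<m) (inner⇒label1 s 2< (λ ()) 2<m)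
                                   (trans (<⇒<ᵇ-true 1<m) (sym (<⇒<ᵇ-true 2<m))))
      where
      1<m = <-trans (s≤s (s≤s z≤n)) 2<m

    leaf-long : side ≡ true → mt 0 ≡ 2 + M × lb (3 + M) ≡ 1
    leaf-long s with <-cmp (mt 0) (2 + M)
    ... | tri≈ _ m≡ _ = m≡ , outer⇒label1 s last< (subst (_< 3 + M) (sym m≡) ≤-refl)
    ... | tri> _ _ m> = ⊥-elim (mt0≢last (≤-antisym (≤-pred (mate< 0<)) m>))
    ... | tri< m< _ _ = ⊥-elim (label1-twice last< last′< (λ e → <-irrefl (sym e) ≤-refl)
                                  (outer⇒label1 s last< m<′) (outer⇒label1 s last′< m<)
                                  (trans (≥⇒<ᵇ-false (<⇒≤ m<′)) (sym (≥⇒<ᵇ-false (<⇒≤ m<)))))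
      where
      m<′ = m<n⇒m<1+n m<

    leaf : (mt 0 ≡ 2 × lb 1 ≡ 1) ⊎ (mt 0 ≡ 2 + M × lb (3 + M) ≡ 1)
    leaf with side in s
    ... | false = inj₁ (leaf-short s)
    ... | true  = inj₂ (leaf-long s)

-- With the leaf at 0–2, the other end of the neighbouring edge at 1 is neither 3 nor the
-- last position: otherwise the edge labelled 2 could not cross it.
module NeighbourPosition (M : ℕ) (mt : ℕ → ℕ) (tw : ℕ → Bool) (n : ℕ) (lb : ℕ → ℕ)
  (G : PathLabelling (diagram (4 + M) mt tw) n lb) (lb0 : lb 0 ≡ 0) (lb1 : lb 1 ≡ 1) (mt0 : mt 0 ≡ 2) (n≥3 : 3 ≤ n) where
  open PathLabelling G
  open Valid valid

  D : Diagram
  D = diagram (4 + M) mt tw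

  0< : 0 < 4 + M
  0< = s≤s z≤n
  1< : 1 < 4 + M
  1< = s≤s (s≤s z≤n)

  y = position 2
  y< : y < 4 + M
  y< = position< n≥3
  my< : mt y < 4 + M
  my< = mate< y<

  label-y : lb y ≡ 2
  label-y = label-position n≥3
  label-my : lb (mt y) ≡ 2
  label-my = trans (label-mate y<) label-y

  crosses-1y : crosses D 1 y ≡ true
  crosses-1y = adjacent⇒crosses 1< y< (inj₁ (trans label-y (cong suc (sym lb1))))

  label2⇒≢mt1 : ∀ {z} → lb z ≡ 2 → z ≢ mt 1
  label2⇒≢mt1 e z≡ with () ← trans (sym e) (trans (cong lb z≡) (trans (label-mate 1<) lb1))

  label2⇒>2 : ∀ {z} → lb z ≡ 2 → 2 < z
  label2⇒>2 {zero}              e rewrite lb0 with () ← e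
  label2⇒>2 {suc zero}          e rewrite lb1 with () ← e
  label2⇒>2 {suc (suc zero)}    e rewrite trans (cong lb (sym mt0)) (trans (label-mate 0<) lb0) with () ← e
  label2⇒>2 {suc (suc (suc z))} e = s≤s (s≤s (s≤s z≤n))

  neighbour : ∃ λ q → mt 1 ≡ 4 + q × 2 + q ≤ M
  neighbour with mt 1 in m1
  ... | zero = case trans (sym (mate-involutive 1<)) (trans (cong mt m1) mt0) of λ ()
  ... | suc zero = ⊥-elim (mate≢ 1< m1)
  ... | suc (suc zero) = case mate-injective 1< 0< (trans m1 (sym mt0)) of λ ()
  ... | suc (suc (suc zero)) = ⊥-elim (true≢false (trans (sym crosses-1y)
          (subst (λ b → cyclic 1 y b xor cyclic 1 (mt y) b ≡ false) (sym m1)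
            (cong₂ _xor_ (cyclic-above (<-trans (s≤s (s≤s z≤n)) (above label-y)) (above label-y))
                         (cyclic-above (<-trans (s≤s (s≤s z≤n)) (above label-my)) (above label-my))))))
    where
    above : ∀ {z} → lb z ≡ 2 → 3 < z
    above e = ≤∧≢⇒< (label2⇒>2 e) (λ z≡3 → label2⇒≢mt1 e (trans (sym z≡3) (sym m1)))
  ... | suc (suc (suc (suc q))) with 2 + q ≤? M
  ...   | yes q≤ = q , refl , q≤
  ...   | no q≰ = ⊥-elim (true≢false (trans (sym crosses-1y)
          (subst (λ b → cyclic 1 y b xor cyclic 1 (mt y) b ≡ false) (sym m1)
            (cong₂ _xor_ (cyclic-increasing (<-trans (s≤s (s≤s z≤n)) (label2⇒>2 label-y)) (below y< label-y))
                         (cyclic-increasing (<-trans (s≤s (s≤s z≤n)) (label2⇒>2 label-my)) (below my< label-my))))))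
    where
    last : 4 + q ≡ 3 + M
    last = ≤-antisym (≤-pred (subst (_< 4 + M) m1 (mate< 1<))) (s≤s (s≤s (≰⇒> q≰)))
    below : ∀ {z} → z < 4 + M → lb z ≡ 2 → z < 4 + q
    below {z} z< e = ≤∧≢⇒< (subst (z ≤_) (sym last) (≤-pred z<)) (λ z≡ → label2⇒≢mt1 e (trans z≡ (sym m1)))

-- Small diagrams, by evaluation

BothDirections : (State → Set) → ℕ → Set
BothDirections P a = P (a , true) × P (a , false)

both? : ∀ {P : State → Set} → (∀ s → Dec (P s)) → ∀ a → Dec (BothDirections P a)
both? P? a = P? (a , true) ×-dec P? (a , false)

forEach : ∀ (P : State → Set) {N} → (∀ {a} → a < N → BothDirections P a) → ∀ {s} → proj₁ s < N → P s
forEach P h {a , true}  a< = proj₁ (h a<)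
forEach P h {a , false} a< = proj₂ (h a<)

-- For a concrete diagram, the defining properties of an orbit labelling become finite
-- checks (reachability within 2 · size steps suffices), decided by evaluation.
module Evaluation (D : Diagram) (label : State → ℕ) (L : ℕ) where

  ReachesWithin : State → State → Set
  ReachesWithin s t = ∃ λ j → j < 2 * size D × iter (step D) j s ≡ t

  SameLabelReaches : State → State → Set
  SameLabelReaches s t = label s ≡ label t → ReachesWithin s t

  Checks : Set
  Checks = (∀ {a} → a < size D → BothDirections (λ s → label s < L) a)
         × (∀ {a} → a < size D → BothDirections (λ s → label (step D s) ≡ label s) a)
         × (∀ {a} → a < size D → BothDirections (λ s → ∀ {b} → b < size D → BothDirections (SameLabelReaches s) b) a)
         × (∀ {l} → l < L → ∃ λ a → a < size D × (label (a , true) ≡ l ⊎ label (a , false) ≡ l))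

  checks? : Dec Checks
  checks? =
          allUpTo? (both? λ s → label s <? L) (size D)
    ×-dec allUpTo? (both? λ s → label (step D s) ≟ label s) (size D)
    ×-dec allUpTo? (both? λ s → allUpTo? (both? λ t → (label s ≟ label t) →-dec reaches? s t) (size D)) (size D)
    ×-dec allUpTo? (λ l → anyUpTo? (λ a → (label (a , true) ≟ l) ⊎-dec (label (a , false) ≟ l)) (size D)) L
    where
    reaches? : ∀ s t → Dec (ReachesWithin s t)
    reaches? s t = anyUpTo? (λ j → ≡-dec _≟_ _≟ᵇ_ (iter (step D) j s) t) (2 * size D)

  orbitLabelling : True checks? → OrbitLabelling D L
  orbitLabelling ok with bounded , invariant , connected , onto ← toWitness ok = record
    { label         = label
    ; label<        = forEach (λ s → label s < L) bounded
    ; label-step    = forEach (λ s → label (step D s) ≡ label s) invariant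
    ; label⇒reaches = λ {s} s< t< e →
        reach (forEach (SameLabelReaches s) (forEach (λ s → ∀ {b} → b < size D → BothDirections (SameLabelReaches s) b) connected s<) t< e)
    ; label-onto    = λ l< → witness (onto l<)
    }
    where
    reach : ∀ {s t} → ReachesWithin s t → Reaches D s t
    reach (j , _ , e) = j , e
    witness : ∀ {l} → (∃ λ a → a < size D × (label (a , true) ≡ l ⊎ label (a , false) ≡ l)) → ∃ λ s → InRange D s × label s ≡ l
    witness (a , a< , inj₁ e) = (a , true)  , a< , e
    witness (a , a< , inj₂ e) = (a , false) , a< , e

loop : Bool → Diagram
loop t = diagram 2 (λ { zero → 1 ; _ → 0 }) (λ _ → t)

crossingPair : Bool → Diagram
crossingPair u = diagram 4 (λ { 0 → 2 ; 1 → 3 ; 2 → 0 ; _ → 1 }) (λ { 1 → u ; 3 → u ; _ → false })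

loop-twisted : OrbitLabelling (loop true) 2
loop-twisted = Evaluation.orbitLabelling (loop true) proj₁ 2 _

loop-untwisted : OrbitLabelling (loop false) 4
loop-untwisted = Evaluation.orbitLabelling (loop false) encode 4 _

crossingPair-labelling : ∀ u → OrbitLabelling (crossingPair u) 2
crossingPair-labelling false = Evaluation.orbitLabelling (crossingPair false) (λ s → bit (not (proj₂ s))) 2 _
crossingPair-labelling true  = Evaluation.orbitLabelling (crossingPair true) label 2 _
  where
  label : State → ℕ
  label (1 , true)  = 1
  label (2 , _)     = 1
  label (3 , false) = 1
  label _           = 0

module _ {N : ℕ} {mt mt′ : ℕ → ℕ} {tw tw′ : ℕ → Bool} (V : Valid (diagram N mt tw))
  (same-mate : ∀ {a} → a < N → mt a ≡ mt′ a) (same-twist : ∀ {a} → a < N → tw a ≡ tw′ a) where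

  private
    D D′ : Diagram
    D  = diagram N mt tw
    D′ = diagram N mt′ tw′

    step-agrees : ∀ {s} → InRange D s → step D s ≡ step D′ s
    step-agrees {a , d} a< rewrite same-mate a< | same-twist a< = refl

    iter-agrees : ∀ j {s} → InRange D s → iter (step D) j s ≡ iter (step D′) j s
    iter-agrees zero    _  = refl
    iter-agrees (suc j) {s} s< = trans (step-agrees {iter (step D) j s} (iter-inRange V j s<)) (cong (step D′) (iter-agrees j s<))

  orbitLabelling-cong : ∀ {L} → OrbitLabelling D′ L → OrbitLabelling D L
  orbitLabelling-cong lab = record
    { label         = label
    ; label<        = label<
    ; label-step    = λ {s} s< → trans (cong label (step-agrees {s} s<)) (label-step s<)
    ; label⇒reaches = λ {s} s< t< e → let j , ej = label⇒reaches s< t< e in j , trans (iter-agrees j s<) ej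
    ; label-onto    = label-onto
    }
    where open OrbitLabelling lab

loop-labelling : ∀ {mt tw t} → Valid (diagram 2 mt tw) → (∀ {a} → a < 2 → tw a ≡ t) → OrbitLabelling (diagram 2 mt tw) (faceOrbits t)
loop-labelling {mt} {tw} {t} V tw≡ = orbitLabelling-cong V swap tw≡ (labelling t)
  where
  open Valid V
  labelling : ∀ t → OrbitLabelling (loop t) (faceOrbits t)
  labelling true  = loop-twisted
  labelling false = loop-untwisted
  swap : ∀ {a} → a < 2 → mt a ≡ mate (loop t) a
  swap {zero} a< with mt 0 in e | mate< a<
  ... | zero  | _ = ⊥-elim (mate≢ a< e)
  ... | suc zero | _ = refl
  ... | suc (suc _) | s≤s (s≤s ())
  swap {suc zero} a< with mt 1 in e | mate< a<
  ... | zero  | _ = refl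
  ... | suc zero | _ = ⊥-elim (mate≢ a< e)
  ... | suc (suc _) | s≤s (s≤s ())
  swap {suc (suc _)} (s≤s (s≤s ()))

crossingPair-case : ∀ {mt tw} → Valid (diagram 4 mt tw) → mt 0 ≡ 2 → tw 0 ≡ false → OrbitLabelling (diagram 4 mt tw) 2
crossingPair-case {mt} {tw} V mt0 tw0 = orbitLabelling-cong V mates twists (crossingPair-labelling (tw 1))
  where
  open Valid V
  open LeafAt02Facts 0 mt tw V mt0
  mt1 : mt 1 ≡ 3
  mt1 with mt 1 in e | mate< 1<
  ... | 0 | _ = case mate-injective 1< 2< (trans e (sym mt2)) of λ ()
  ... | 1 | _ = ⊥-elim (mate≢ 1< e)
  ... | 2 | _ = case mate-injective 1< 0< (trans e (sym mt0)) of λ ()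
  ... | 3 | _ = refl
  ... | suc (suc (suc (suc _))) | s≤s (s≤s (s≤s (s≤s ())))
  mates : ∀ {a} → a < 4 → mt a ≡ mate (crossingPair (tw 1)) a
  mates {0} _ = mt0
  mates {1} _ = mt1
  mates {2} _ = mt2
  mates {3} _ = trans (cong mt (sym mt1)) (mate-involutive 1<)
  mates {suc (suc (suc (suc _)))} (s≤s (s≤s (s≤s (s≤s ()))))
  twists : ∀ {a} → a < 4 → tw a ≡ twisted (crossingPair (tw 1)) a
  twists {0} _ = tw0
  twists {1} _ = refl
  twists {2} _ = trans tw2 tw0
  twists {3} _ = trans (cong tw (sym mt1)) (twisted-mate 1<)
  twists {suc (suc (suc (suc _)))} (s≤s (s≤s (s≤s (s≤s ()))))

-- Orbits of path diagrams

OrbitLabelledWhen : ℕ → (ℕ → Bool) → ℕ → ℕ → ((ℕ → ℕ) → (ℕ → ℕ) → Set) → Set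
OrbitLabelledWhen n τ L N Q = ∀ mt tw lb → PathLabelling (diagram N mt tw) n lb → TwistedBy (diagram N mt tw) lb τ → Q mt lb →
  OrbitLabelling (diagram N mt tw) L

LeafAt02 : (ℕ → ℕ) → (ℕ → ℕ) → Set
LeafAt02 mt lb = mt 0 ≡ 2 × lb 0 ≡ 0 × lb 1 ≡ 1

module Normalise (n : ℕ) (τ : ℕ → Bool) (L : ℕ) where

  rotateTo : ∀ {N mt tw lb} k → k < N → PathLabelling (diagram N mt tw) n lb → TwistedBy (diagram N mt tw) lb τ →
    OrbitLabelledWhen n τ L N (λ _ lb′ → lb′ 0 ≡ lb k) → OrbitLabelling (diagram N mt tw) L
  rotateTo zero _ G T h = h _ _ _ G T refl
  rotateTo {N} {lb = lb} (suc k) k< G T h =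
    rotate (rotateTo k (<-trans (n<1+n k) k<) (rotated-pathLabelling G) (rotated-twistedBy {τ = τ} T)
      λ mt′ tw′ lb′ G′ T′ e → h mt′ tw′ lb′ G′ T′ (trans e (cong lb (next-nowrap (λ e → <-irrefl e k<)))))
    where open RotateForward (PathLabelling.valid G)

  leafTo02 : ∀ {M} → 2 ≤ n → OrbitLabelledWhen n τ L (4 + M) LeafAt02 → OrbitLabelledWhen n τ L (4 + M) (λ _ lb → lb 0 ≡ 0)
  leafTo02 {M} n≥2 h mt tw lb G T lb0 with LeafPosition.leaf M mt tw n lb G lb0 n≥2
  ... | inj₁ (mt0 , lb1) = h mt tw lb G T (mt0 , lb0 , lb1)
  -- Rotating back by two positions moves the leaf 0–(2 + M) to 0–2.
  ... | inj₂ (mt0 , lb-last) = R₁.rotate (R₂.rotate (h _ _ _ (R₂.rotated-pathLabelling (R₁.rotated-pathLabelling G))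
                                 (R₂.rotated-twistedBy {τ = τ} (R₁.rotated-twistedBy {τ = τ} T)) (mt0′ , lb0′ , lb-last)))
    where
    V = PathLabelling.valid G
    module R₁ = RotateBackward V
    module R₂ = RotateBackward R₁.rotated-valid
    lb0′ : lb (2 + M) ≡ 0
    lb0′ = trans (cong lb (sym mt0)) (trans (PathLabelling.label-mate G (s≤s z≤n)) lb0)
    mt0′ : next (4 + M) (next (4 + M) (mt (2 + M))) ≡ 2
    mt0′ rewrite trans (cong mt (sym mt0)) (Valid.mate-involutive V (s≤s z≤n)) = refl

  normalise : ∀ m → n ≡ 2 + m → OrbitLabelledWhen n τ L (4 + (m + m)) LeafAt02 →
    ∀ D lb → PathLabelling D n lb → TwistedBy D lb τ → OrbitLabelling D L
  normalise m refl h (diagram N mt tw) lb G T with trans (PathLabelling.size≡ G) (cong (2 +_) (trans (+-suc m (suc m)) (cong suc (+-suc m m))))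
  ... | refl = rotateTo (position 0) (position< (s≤s z≤n)) G T
                 λ mt′ tw′ lb′ G′ T′ e → leafTo02 (s≤s (s≤s z≤n)) h mt′ tw′ lb′ G′ T′ (trans e (label-position (s≤s z≤n)))
    where open PathLabelling G

orbitsByContinuant-1 : OrbitsByContinuant 1
orbitsByContinuant-1 (diagram N mt tw) lb τ G T with PathLabelling.size≡ G
... | refl = loop-labelling valid λ a< → trans (T a<) (cong τ (n<1⇒n≡0 (label< a<)))
  where open PathLabelling G

reduceUntwisted : ∀ m τ → (∀ {k} → k < 2 + m → 1 ≤ k → OrbitsByContinuant k) → ∀ mt tw lb →
  PathLabelling (diagram (4 + (m + m)) mt tw) (2 + m) lb → TwistedBy (diagram (4 + (m + m)) mt tw) lb τ →
  mt 0 ≡ 2 → lb 0 ≡ 0 → lb 1 ≡ 1 → tw 0 ≡ false →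
  OrbitLabelling (diagram (4 + (m + m)) mt tw) (faceOrbits (continuant (applyUpTo τ (2 + m))))
reduceUntwisted zero τ _ mt tw lb G T mt0 lb0 _ tw0
  rewrite trans (cong τ (sym lb0)) (trans (sym (T (s≤s z≤n))) tw0) = crossingPair-case (PathLabelling.valid G) mt0 tw0
reduceUntwisted (suc m) τ IH mt tw lb G T mt0 lb0 lb1 tw0
  with q , mt1 , q< ← NeighbourPosition.neighbour (suc m + suc m) mt tw (3 + m) lb G lb0 lb1 mt0 (s≤s (s≤s (s≤s z≤n)))
  = UntwistedLeafPath.reduce (suc m + suc m) q mt tw (suc m) lb τ G T mt0 tw0 mt1 q< lb0 lb1 (IH (m<n⇒m<1+n ≤-refl) (s≤s z≤n))

reduceLeaf : ∀ m τ → (∀ {k} → k < 2 + m → 1 ≤ k → OrbitsByContinuant k) →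
  OrbitLabelledWhen (2 + m) τ (faceOrbits (continuant (applyUpTo τ (2 + m)))) (4 + (m + m)) LeafAt02
reduceLeaf m τ IH mt tw lb G T (mt0 , lb0 , lb1) with tw 0 in tw0
... | true  = TwistedLeafPath.reduce (m + m) mt tw (suc m) lb τ G T mt0 lb0 lb1 tw0 (IH ≤-refl (s≤s z≤n))
... | false = reduceUntwisted m τ IH mt tw lb G T mt0 lb0 lb1 tw0

orbitsByContinuant : ∀ n → 1 ≤ n → OrbitsByContinuant n
orbitsByContinuant = <-rec (λ n → 1 ≤ n → OrbitsByContinuant n) induction
  where
  induction : ∀ n → (∀ {k} → k < n → 1 ≤ k → OrbitsByContinuant k) → 1 ≤ n → OrbitsByContinuant n
  induction (suc zero)    _  _ = orbitsByContinuant-1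
  induction (suc (suc m)) IH _ D lb τ = Normalise.normalise (2 + m) τ _ m refl (reduceLeaf m τ IH) D lb

-- Bouquets as chord diagrams

between : ℕ → ℕ → ℕ → Bool
between l h z = (l <ᵇ z) ∧ (z <ᵇ h)

cyclic-increasing-ends : ∀ {x x′ y} → x < x′ → cyclic x y x′ ≡ between x x′ y
cyclic-increasing-ends {x} {x′} {y} x<x′ rewrite ≥⇒<ᵇ-false {x′} {x} (<⇒≤ x<x′) with x <ᵇ y | y <ᵇ x′
... | true  | true  = refl
... | true  | false = refl
... | false | true  = refl
... | false | false = refl

cyclic-decreasing-ends : ∀ {x x′ y} → x′ < x → y ≢ x → y ≢ x′ → cyclic x y x′ ≡ not (between x′ x y)
cyclic-decreasing-ends {x} {x′} {y} x′<x y≢x y≢x′ rewrite <⇒<ᵇ-true x′<x with <-cmp y x′ | <-cmp y x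
... | tri≈ _ e _ | _ = ⊥-elim (y≢x′ e)
... | _ | tri≈ _ e _ = ⊥-elim (y≢x e)
... | tri< a _ _ | tri< b _ _ rewrite <⇒<ᵇ-true a | ≥⇒<ᵇ-false {x} {y} (<⇒≤ b) | ≥⇒<ᵇ-false {x′} {y} (<⇒≤ a) = refl
... | tri> _ _ a | tri> _ _ b rewrite ≥⇒<ᵇ-false {y} {x′} (<⇒≤ a) | <⇒<ᵇ-true b | <⇒<ᵇ-true a | ≥⇒<ᵇ-false {y} {x} (<⇒≤ b) = refl
... | tri< a _ _ | tri> _ _ b = ⊥-elim (<-irrefl refl (<-trans (<-trans a x′<x) b))
... | tri> _ _ a | tri< b _ _ rewrite ≥⇒<ᵇ-false {y} {x′} (<⇒≤ a) | ≥⇒<ᵇ-false {x} {y} (<⇒≤ b) | <⇒<ᵇ-true a | <⇒<ᵇ-true b = refl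

-- Whether exactly one of y, y′ lies on the arc from x to x′ does not depend on which
-- of the two arcs is taken, so it can be read off the interval between min and max.
arc-xor⇒interval-xor : ∀ {x x′ y y′} → x ≢ x′ → y ≢ x → y ≢ x′ → y′ ≢ x → y′ ≢ x′ →
  (cyclic x y x′ xor cyclic x y′ x′) ≡ (between (x ⊓ x′) (x ⊔ x′) y xor between (x ⊓ x′) (x ⊔ x′) y′)
arc-xor⇒interval-xor {x} {x′} {y} {y′} x≢x′ y≢x y≢x′ y′≢x y′≢x′ with <-cmp x x′
... | tri≈ _ e _ = ⊥-elim (x≢x′ e)
... | tri< x<x′ _ _ rewrite m≤n⇒m⊓n≡m (<⇒≤ x<x′) | m≤n⇒m⊔n≡n (<⇒≤ x<x′)
      | cyclic-increasing-ends {x} {x′} {y} x<x′ | cyclic-increasing-ends {x} {x′} {y′} x<x′ = refl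
... | tri> _ _ x′<x rewrite m≥n⇒m⊓n≡n (<⇒≤ x′<x) | m≥n⇒m⊔n≡m (<⇒≤ x′<x)
      | cyclic-decreasing-ends x′<x y≢x y≢x′ | cyclic-decreasing-ends x′<x y′≢x y′≢x′ = not-xor-not (between x′ x y) (between x′ x y′)
  where
  not-xor-not : ∀ a b → not a xor not b ≡ a xor b
  not-xor-not true  b = refl
  not-xor-not false b = not-involutive b

between-xor-sorted : ∀ l h {y y′} → y ≢ y′ → (between l h y xor between l h y′) ≡ (between l h (y ⊓ y′) xor between l h (y ⊔ y′))
between-xor-sorted l h {y} {y′} y≢y′ with <-cmp y y′
... | tri≈ _ e _ = ⊥-elim (y≢y′ e)
... | tri< y<y′ _ _ rewrite m≤n⇒m⊓n≡m (<⇒≤ y<y′) | m≤n⇒m⊔n≡n (<⇒≤ y<y′) = refl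
... | tri> _ _ y′<y rewrite m≥n⇒m⊓n≡n (<⇒≤ y′<y) | m≥n⇒m⊔n≡m (<⇒≤ y′<y) = xor-comm (between l h y) (between l h y′)

Alternating : ℕ → ℕ → ℕ → ℕ → Set
Alternating l h l′ h′ = (l < l′ × l′ < h × h < h′) ⊎ (l′ < l × l < h′ × h′ < h)

alternating⇒between-xor : ∀ {l h l′ h′} → Alternating l h l′ h′ → (between l h l′ xor between l h h′) ≡ true
alternating⇒between-xor (inj₁ (l<l′ , l′<h , h<h′)) rewrite <⇒<ᵇ-true l<l′ | <⇒<ᵇ-true l′<h
  | <⇒<ᵇ-true (<-trans l<l′ (<-trans l′<h h<h′)) | ≥⇒<ᵇ-false (<⇒≤ h<h′) = refl
alternating⇒between-xor (inj₂ (l′<l , l<h′ , h′<h)) rewrite ≥⇒<ᵇ-false (<⇒≤ l′<l) | <⇒<ᵇ-true l<h′ | <⇒<ᵇ-true h′<h = refl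

between-xor⇒alternating : ∀ {l h l′ h′} → l′ < h′ → l ≢ l′ → h ≢ h′ →
  (between l h l′ xor between l h h′) ≡ true → Alternating l h l′ h′
between-xor⇒alternating {l} {h} {l′} {h′} l′<h′ l≢l′ h≢h′ e with l <ᵇ l′ in e₁ | l′ <ᵇ h in e₂ | l <ᵇ h′ in e₃ | h′ <ᵇ h in e₄
... | true  | true  | _     | false = inj₁ (<ᵇ-true⇒< e₁ , <ᵇ-true⇒< e₂ , ≤∧≢⇒< (<ᵇ-false⇒≥ e₄) h≢h′)
... | false | _     | true  | true  = inj₂ (≤∧≢⇒< (<ᵇ-false⇒≥ e₁) (λ x → l≢l′ (sym x)) , <ᵇ-true⇒< e₃ , <ᵇ-true⇒< e₄)
... | true  | true  | false | true  = ⊥-elim (true≢false (trans (sym (<⇒<ᵇ-true (<-trans (<ᵇ-true⇒< e₁) l′<h′))) e₃))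
... | true  | true  | true  | true  with () ← e
... | true  | false | true  | true  = ⊥-elim (true≢false (trans (sym (<⇒<ᵇ-true (<-trans l′<h′ (<ᵇ-true⇒< {h′} {h} e₄)))) e₂))
... | false | _     | false | _     with () ← e
... | false | _     | true  | false with () ← e
... | true  | false | false | _     with () ← e
... | true  | false | true  | false with () ← e

-- Positions of the bouquet are Fin K; its diagram uses their values in ℕ.  A corner
-- state (c , d) of faceStep corresponds to arriving at the end at c + 1 (if d) or at c.
module BouquetDiagram (m : ℕ) (B : Bouquet (suc m)) where

  K : ℕ
  K = suc m + suc m

  toFin : ℕ → Fin K
  toFin a = a mod K

  toℕ-toFin : ∀ {a} → a < K → toℕ (toFin a) ≡ a
  toℕ-toFin a< = trans (toℕ-fromℕ< _) (m<n⇒m%n≡m a<)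

  toFin-toℕ : ∀ (x : Fin K) → toFin (toℕ x) ≡ x
  toFin-toℕ x = toℕ-injective (toℕ-toFin (toℕ<n x))

  otherEnd : Fin (suc m) × Bool → Fin (suc m) × Bool
  otherEnd (e , s) = e , not s

  endPos-endAt : ∀ i → endPos B (endAt B i) ≡ i
  endPos-endAt i = Inverse.inverseˡ (ends B) refl

  endAt-endPos : ∀ e → endAt B (endPos B e) ≡ e
  endAt-endPos e = Inverse.inverseʳ (ends B) refl

  edgeAt : ℕ → Fin (suc m)
  edgeAt a = proj₁ (endAt B (toFin a))

  D : Diagram
  D = diagram K (λ a → toℕ (endPos B (otherEnd (endAt B (toFin a))))) (twist B ∘′ edgeAt)

  endAt-mate : ∀ {a} → a < K → endAt B (toFin (mate D a)) ≡ otherEnd (endAt B (toFin a))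
  endAt-mate a< = trans (cong (endAt B) (toFin-toℕ _)) (endAt-endPos _)

  valid : Valid D
  valid = record
    { mate<           = λ _ → toℕ<n _
    ; mate-involutive = λ {a} a< → trans (cong (toℕ ∘′ endPos B ∘′ otherEnd) (endAt-mate a<))
                          (trans (cong (toℕ ∘′ endPos B) (otherEnd-involutive _)) (trans (cong toℕ (endPos-endAt _)) (toℕ-toFin a<)))
    ; mate≢           = λ {a} a< e → not-≢ (cong proj₂ (trans (sym (endAt-mate a<)) (cong (endAt B ∘′ toFin) e)))
    ; twisted-mate    = λ a< → cong (twist B ∘′ proj₁) (endAt-mate a<)
    }
    where
    otherEnd-involutive : ∀ x → otherEnd (otherEnd x) ≡ x
    otherEnd-involutive (e , s) = cong (e ,_) (not-involutive s)
    not-≢ : ∀ {s} → not s ≢ s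
    not-≢ {true}  ()
    not-≢ {false} ()

  toℕ-cyc+ : ∀ (c : Fin K) → toℕ (cyc+ c) ≡ next K (toℕ c)
  toℕ-cyc+ c with suc (toℕ c) ≟ K
  ... | yes e rewrite next-wrap {K} {toℕ c} e = trans (toℕ-fromℕ< _) (trans (cong (_% K) e) (n%n≡0 K))
  ... | no ne rewrite next-nowrap {K} {toℕ c} ne = trans (toℕ-fromℕ< _) (m<n⇒m%n≡m (≤∧≢⇒< (toℕ<n c) ne))

  toℕ-cyc- : ∀ (c : Fin K) → toℕ (cyc- c) ≡ prev K (toℕ c)
  toℕ-cyc- c with toℕ c in ec
  ... | zero  = trans (toℕ-fromℕ< _) (m<n⇒m%n≡m {n = K} ≤-refl)
  ... | suc x = trans (toℕ-fromℕ< _) (trans (cong (_% K) (sym (+-suc x (m + suc m))))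
                  (trans ([m+n]%n≡m%n x K) (m<n⇒m%n≡m (<-trans (n<1+n x) (subst (_< K) ec (toℕ<n c))))))

  arrival : Fin K × Bool → State
  arrival (c , true)  = toℕ (cyc+ c) , true
  arrival (c , false) = toℕ c , false

  arrival-faceStep : ∀ s → arrival (faceStep B s) ≡ step D (arrival s)
  arrival-faceStep (c , true) rewrite toFin-toℕ (cyc+ c) with true xor twist B (proj₁ (endAt B (cyc+ c)))
  ... | true  = cong (_, true)  (toℕ-cyc+ (endPos B (otherEnd (endAt B (cyc+ c)))))
  ... | false = cong (_, false) (toℕ-cyc- (endPos B (otherEnd (endAt B (cyc+ c)))))
  arrival-faceStep (c , false) rewrite toFin-toℕ c with false xor twist B (proj₁ (endAt B c))
  ... | true  = cong (_, true)  (toℕ-cyc+ (endPos B (otherEnd (endAt B c))))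
  ... | false = cong (_, false) (toℕ-cyc- (endPos B (otherEnd (endAt B c))))

  arrival-iter : ∀ j s → arrival (iter (faceStep B) j s) ≡ iter (step D) j (arrival s)
  arrival-iter zero    s = refl
  arrival-iter (suc j) s = trans (arrival-faceStep (iter (faceStep B) j s)) (cong (step D) (arrival-iter j s))

  arrival-inRange : ∀ s → InRange D (arrival s)
  arrival-inRange (c , true)  = toℕ<n _
  arrival-inRange (c , false) = toℕ<n _

  arrival-injective : ∀ s t → arrival s ≡ arrival t → s ≡ t
  arrival-injective (c , true) (c′ , true) e =
    cong (_, true) (toℕ-injective (next-injective (toℕ<n c) (toℕ<n c′) (trans (sym (toℕ-cyc+ c)) (trans (cong proj₁ e) (toℕ-cyc+ c′)))))
  arrival-injective (c , false) (c′ , false) e = cong (_, false) (toℕ-injective (cong proj₁ e))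

  arrival-onto : ∀ {x} → InRange D x → ∃ λ s → arrival s ≡ x
  arrival-onto {a , true}  a< = (cyc- (toFin a) , true) , cong (_, true)
    (trans (toℕ-cyc+ (cyc- (toFin a))) (trans (cong (next K) (toℕ-cyc- (toFin a))) (trans (cong (next K ∘′ prev K) (toℕ-toFin a<)) (next-prev a<))))
  arrival-onto {a , false} a< = (toFin a , false) , cong (_, false) (toℕ-toFin a<)

⊓<⊔ : ∀ {x y} → x ≢ y → x ⊓ y < x ⊔ y
⊓<⊔ {x} {y} x≢y with <-cmp x y
... | tri< x<y _ _ rewrite m≤n⇒m⊓n≡m (<⇒≤ x<y) | m≤n⇒m⊔n≡n (<⇒≤ x<y) = x<y
... | tri≈ _ e _   = ⊥-elim (x≢y e)
... | tri> _ _ y<x rewrite m≥n⇒m⊓n≡n (<⇒≤ y<x) | m≥n⇒m⊔n≡m (<⇒≤ y<x) = y<x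

⊓-distinct : ∀ {x x′ y y′} → y ≢ x → y ≢ x′ → y′ ≢ x → y′ ≢ x′ → x ⊓ x′ ≢ y ⊓ y′
⊓-distinct {x} {x′} {y} {y′} d₁ d₂ d₃ d₄ e with ⊓-sel x x′ | ⊓-sel y y′
... | inj₁ p | inj₁ q = d₁ (sym (trans (sym p) (trans e q)))
... | inj₁ p | inj₂ q = d₃ (sym (trans (sym p) (trans e q)))
... | inj₂ p | inj₁ q = d₂ (sym (trans (sym p) (trans e q)))
... | inj₂ p | inj₂ q = d₄ (sym (trans (sym p) (trans e q)))

⊔-distinct : ∀ {x x′ y y′} → y ≢ x → y ≢ x′ → y′ ≢ x → y′ ≢ x′ → x ⊔ x′ ≢ y ⊔ y′
⊔-distinct {x} {x′} {y} {y′} d₁ d₂ d₃ d₄ e with ⊔-sel x x′ | ⊔-sel y y′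
... | inj₁ p | inj₁ q = d₁ (sym (trans (sym p) (trans e q)))
... | inj₁ p | inj₂ q = d₃ (sym (trans (sym p) (trans e q)))
... | inj₂ p | inj₁ q = d₂ (sym (trans (sym p) (trans e q)))
... | inj₂ p | inj₂ q = d₄ (sym (trans (sym p) (trans e q)))

module BouquetPath (m : ℕ) (B : Bouquet (suc m)) (σ : Fin (suc m) ↔ Fin (suc m))
  (H : ∀ e f → Interlaced B e f ⇔ PathAdj (Inverse.to σ e) (Inverse.to σ f)) where
  open BouquetDiagram m B
  open Valid valid

  edgeAt-mate : ∀ {a} → a < K → edgeAt (mate D a) ≡ edgeAt a
  edgeAt-mate a< = cong proj₁ (endAt-mate a<)

  position-endAt : ∀ {a} → a < K → ∀ {x} → endAt B (toFin a) ≡ x → a ≡ toℕ (endPos B x)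
  position-endAt {a} a< {x} e = trans (sym (toℕ-toFin a<)) (cong toℕ (trans (sym (endPos-endAt _)) (cong (endPos B) e)))

  lo-hi : ∀ {a} → a < K → lo B (edgeAt a) ≡ a ⊓ mate D a × hi B (edgeAt a) ≡ a ⊔ mate D a
  lo-hi {a} a< with endAt B (toFin a) in eq
  ... | e , true  rewrite sym (position-endAt a< eq) = refl , refl
  ... | e , false rewrite sym (position-endAt a< eq) = ⊓-comm _ a , ⊔-comm _ a

  same-edge : ∀ {a b} → a < K → b < K → edgeAt a ≡ edgeAt b → b ≡ a ⊎ b ≡ mate D a
  same-edge {a} {b} a< b< e with endAt B (toFin a) in ea | endAt B (toFin b) in eb
  same-edge {a} {b} a< b< refl | x , s | .x , t with s | t
  ... | true  | true  = inj₁ (trans (position-endAt b< eb) (sym (position-endAt a< ea)))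
  ... | false | false = inj₁ (trans (position-endAt b< eb) (sym (position-endAt a< ea)))
  ... | true  | false = inj₂ (position-endAt b< eb)
  ... | false | true  = inj₂ (position-endAt b< eb)

  crosses-same-edge : ∀ {a b} → a < K → b < K → edgeAt a ≡ edgeAt b → crosses D a b ≡ false
  crosses-same-edge {a} a< b< e with same-edge a< b< e
  ... | inj₁ refl = cong₂ _xor_ (cyclic-repeat-start a (mate D a)) (cyclic-repeat-end a (mate D a))
  ... | inj₂ refl rewrite mate-involutive a< = cong₂ _xor_ (cyclic-repeat-end a (mate D a)) (cyclic-repeat-start a (mate D a))

  module _ {a b} (a< : a < K) (b< : b < K) (ne : edgeAt a ≢ edgeAt b) where
    private
      a′ = mate D a
      b′ = mate D b
      d₁ : b ≢ a
      d₁ e = ne (cong edgeAt (sym e))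
      d₂ : b ≢ a′
      d₂ e = ne (trans (sym (edgeAt-mate a<)) (cong edgeAt (sym e)))
      d₃ : b′ ≢ a
      d₃ e = ne (trans (cong edgeAt (sym e)) (edgeAt-mate b<))
      d₄ : b′ ≢ a′
      d₄ e = ne (trans (sym (edgeAt-mate a<)) (trans (cong edgeAt (sym e)) (edgeAt-mate b<)))

      crosses≡ : crosses D a b ≡ (between (a ⊓ a′) (a ⊔ a′) (b ⊓ b′) xor between (a ⊓ a′) (a ⊔ a′) (b ⊔ b′))
      crosses≡ = trans (arc-xor⇒interval-xor (λ e → mate≢ a< (sym e)) d₁ d₂ d₃ d₄) (between-xor-sorted (a ⊓ a′) (a ⊔ a′) (λ e → mate≢ b< (sym e)))

    crosses⇒interlaced : crosses D a b ≡ true → Interlaced B (edgeAt a) (edgeAt b)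
    crosses⇒interlaced c rewrite proj₁ (lo-hi a<) | proj₂ (lo-hi a<) | proj₁ (lo-hi b<) | proj₂ (lo-hi b<) =
      between-xor⇒alternating (⊓<⊔ (λ e → mate≢ b< (sym e))) (⊓-distinct d₁ d₂ d₃ d₄) (⊔-distinct d₁ d₂ d₃ d₄) (trans (sym crosses≡) c)

    interlaced⇒crosses : Interlaced B (edgeAt a) (edgeAt b) → crosses D a b ≡ true
    interlaced⇒crosses i rewrite proj₁ (lo-hi a<) | proj₂ (lo-hi a<) | proj₁ (lo-hi b<) | proj₂ (lo-hi b<) =
      trans crosses≡ (alternating⇒between-xor i)

  label : ℕ → ℕ
  label a = toℕ (Inverse.to σ (edgeAt a))

  τ : ℕ → Bool
  τ i = twist B (Inverse.from σ (i mod suc m))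

  from-to : ∀ x → Inverse.from σ (Inverse.to σ x) ≡ x
  from-to x = Inverse.inverseʳ σ refl

  to-from : ∀ x → Inverse.to σ (Inverse.from σ x) ≡ x
  to-from x = Inverse.inverseˡ σ refl

  mod-toℕ : ∀ (x : Fin (suc m)) → toℕ x mod suc m ≡ x
  mod-toℕ x = toℕ-injective (trans (toℕ-fromℕ< _) (m<n⇒m%n≡m (toℕ<n x)))

  pathLabelling : PathLabelling D (suc m) label
  pathLabelling = record
    { valid            = valid
    ; size≡            = refl
    ; label<           = λ _ → toℕ<n _
    ; label-mate       = λ a< → cong (toℕ ∘′ Inverse.to σ) (edgeAt-mate a<)
    ; label-injective  = λ a< b< e → same-edge a< b< (trans (sym (from-to _)) (trans (cong (Inverse.from σ) (toℕ-injective e)) (from-to _)))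
    ; position         = λ i → toℕ (endPos B (Inverse.from σ (i mod suc m) , true))
    ; position<        = λ _ → toℕ<n _
    ; label-position   = λ i< → trans (cong (toℕ ∘′ Inverse.to σ ∘′ proj₁) (trans (cong (endAt B) (toFin-toℕ _)) (endAt-endPos _)))
                                  (trans (cong toℕ (to-from _)) (trans (toℕ-fromℕ< _) (m<n⇒m%n≡m i<)))
    ; crosses⇒adjacent = crosses⇒adjacent
    ; adjacent⇒crosses = adjacent⇒crosses
    }
    where
    crosses⇒adjacent : ∀ {a b} → a < K → b < K → crosses D a b ≡ true → Adjacent (label a) (label b)
    crosses⇒adjacent {a} {b} a< b< c with edgeAt a Fin.≟ edgeAt b
    ... | yes e = ⊥-elim (true≢false (trans (sym c) (crosses-same-edge a< b< e)))
    ... | no ne = Equivalence.to (H (edgeAt a) (edgeAt b)) (crosses⇒interlaced a< b< ne c)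
    adjacent⇒crosses : ∀ {a b} → a < K → b < K → Adjacent (label a) (label b) → crosses D a b ≡ true
    adjacent⇒crosses {a} {b} a< b< adj with edgeAt a Fin.≟ edgeAt b
    ... | yes e = ⊥-elim (not-self-interlaced (subst (λ x → Interlaced B x (edgeAt b)) e (Equivalence.from (H (edgeAt a) (edgeAt b)) adj)))
      where
      not-self-interlaced : ∀ {x} → Interlaced B x x → ⊥
      not-self-interlaced (inj₁ (l< , _)) = <-irrefl refl l<
      not-self-interlaced (inj₂ (l< , _)) = <-irrefl refl l<
    ... | no ne = interlaced⇒crosses a< b< ne (Equivalence.from (H (edgeAt a) (edgeAt b)) adj)

  twistedBy : TwistedBy D label τ
  twistedBy {a} a< = cong (twist B) (sym (trans (cong (Inverse.from σ) (mod-toℕ _)) (from-to _)))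

-- Counting orbits of faceStep

module _ {X : Set} where

  countB-cong : ∀ {p q : X → Bool} xs → (∀ x → p x ≡ q x) → countB p xs ≡ countB q xs
  countB-cong []       e = refl
  countB-cong (x ∷ xs) e = cong₂ _+_ (cong bit (e x)) (countB-cong xs e)

  countB-++ : ∀ (p : X → Bool) xs ys → countB p (xs ++ ys) ≡ countB p xs + countB p ys
  countB-++ p []       ys = refl
  countB-++ p (x ∷ xs) ys = trans (cong (bit (p x) +_) (countB-++ p xs ys)) (sym (+-assoc (bit (p x)) (countB p xs) (countB p ys)))

  countB-map : ∀ {Y : Set} (p : Y → Bool) (f : X → Y) xs → countB p (map f xs) ≡ countB (p ∘′ f) xs
  countB-map p f []       = refl
  countB-map p f (x ∷ xs) = cong (bit (p (f x)) +_) (countB-map p f xs)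

  countB-mono : ∀ {p q : X → Bool} xs → (∀ x → q x ≡ true → p x ≡ true) → countB q xs ≤ countB p xs
  countB-mono     []       _ = z≤n
  countB-mono {p} {q} (x ∷ xs) h with q x in eq
  ... | true  rewrite h x eq = s≤s (countB-mono xs h)
  ... | false = ≤-trans (countB-mono xs h) (m≤n+m _ _)

  countB-none : ∀ (p : X → Bool) xs → (∀ x → p x ≡ false) → countB p xs ≡ 0
  countB-none p []       _ = refl
  countB-none p (x ∷ xs) h rewrite h x = countB-none p xs h

  countB-witness : ∀ (p : X → Bool) xs → countB p xs ≢ 0 → ∃ λ x → p x ≡ true
  countB-witness p []       ne = ⊥-elim (ne refl)
  countB-witness p (x ∷ xs) ne with p x in eq
  ... | true  = x , eq
  ... | false = countB-witness p xs ne

sumTo : ℕ → (ℕ → ℕ) → ℕ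
sumTo zero    f = 0
sumTo (suc L) f = sumTo L f + f L

sumTo-+ : ∀ L (f g : ℕ → ℕ) → sumTo L (λ l → f l + g l) ≡ sumTo L f + sumTo L g
sumTo-+ zero    f g = refl
sumTo-+ (suc L) f g rewrite sumTo-+ L f g = interchange (sumTo L f) (sumTo L g) (f L) (g L)

sumTo-0 : ∀ L {f : ℕ → ℕ} → (∀ {l} → l < L → f l ≡ 0) → sumTo L f ≡ 0
sumTo-0 zero    _ = refl
sumTo-0 (suc L) e rewrite sumTo-0 L (λ l< → e (m<n⇒m<1+n l<)) | e (n<1+n L) = refl

sumTo-1 : ∀ L {f : ℕ → ℕ} → (∀ {l} → l < L → f l ≡ 1) → sumTo L f ≡ L
sumTo-1 zero    _ = refl
sumTo-1 (suc L) e rewrite sumTo-1 L (λ l< → e (m<n⇒m<1+n l<)) | e (n<1+n L) = +-comm L 1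

sumTo-indicator : ∀ L {v} → v < L → sumTo L (λ l → bit (v ≡ᵇ l)) ≡ 1
sumTo-indicator (suc L) {v} v< with v ≟ L
... | yes refl rewrite ≡⇒≡ᵇ-true {v} refl = cong (_+ 1) (sumTo-0 v (λ l< → cong bit (≢⇒≡ᵇ-false (λ e → <-irrefl (sym e) l<))))
... | no ne    rewrite ≢⇒≡ᵇ-false ne = trans (+-identityʳ _) (sumTo-indicator L (≤∧≢⇒< (≤-pred v<) ne))

countB-byValue : ∀ {X : Set} L (g : X → ℕ) (p : X → Bool) xs → (∀ x → g x < L) →
  countB p xs ≡ sumTo L (λ l → countB (λ x → p x ∧ (g x ≡ᵇ l)) xs)
countB-byValue L g p []       _ = sym (sumTo-0 L (λ _ → refl))
countB-byValue L g p (x ∷ xs) h = trans (cong₂ _+_ head (countB-byValue L g p xs h)) (sym (sumTo-+ L _ _))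
  where
  head : bit (p x) ≡ sumTo L (λ l → bit (p x ∧ (g x ≡ᵇ l)))
  head with p x
  ... | true  = sym (sumTo-indicator L (h x))
  ... | false = sym (sumTo-0 L (λ _ → refl))

and-applyUpTo⇒ : ∀ (f : ℕ → Bool) g K → and (map f (applyUpTo g K)) ≡ true → ∀ {k} → k < K → f (g k) ≡ true
and-applyUpTo⇒ f g (suc K) e {k} k< with f (g 0) in e₀
and-applyUpTo⇒ f g (suc K) e {zero}  _         | true = e₀
and-applyUpTo⇒ f g (suc K) e {suc k} (s≤s k<) | true = and-applyUpTo⇒ f (g ∘′ suc) K e k<

⇒and-applyUpTo : ∀ (f : ℕ → Bool) g K → (∀ {k} → k < K → f (g k) ≡ true) → and (map f (applyUpTo g K)) ≡ true
⇒and-applyUpTo f g zero    _ = refl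
⇒and-applyUpTo f g (suc K) h rewrite h {0} (s≤s z≤n) = ⇒and-applyUpTo f (g ∘′ suc) K (λ k< → h (s≤s k<))

sumFin : ∀ K → (Fin K → ℕ) → ℕ
sumFin zero    h = 0
sumFin (suc K) h = h Fin.zero + sumFin K (h ∘′ Fin.suc)

sumFin-cong : ∀ K {h h′ : Fin K → ℕ} → (∀ i → h i ≡ h′ i) → sumFin K h ≡ sumFin K h′
sumFin-cong zero    _ = refl
sumFin-cong (suc K) e = cong₂ _+_ (e Fin.zero) (sumFin-cong K (λ i → e (Fin.suc i)))

sumFin-0 : ∀ K (h : Fin K → ℕ) → (∀ i → h i ≡ 0) → sumFin K h ≡ 0
sumFin-0 zero    h _ = refl
sumFin-0 (suc K) h e rewrite e Fin.zero = sumFin-0 K (h ∘′ Fin.suc) (λ i → e (Fin.suc i))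

countB-states : ∀ {K′} K (f : Fin K → Fin K′) (p : Fin K′ × Bool → Bool) →
  countB p (concatMap (λ c → (c , true) ∷ (c , false) ∷ []) (List.tabulate f)) ≡ sumFin K (λ i → bit (p (f i , true)) + bit (p (f i , false)))
countB-states zero    f p = refl
countB-states (suc K) f p = trans (sym (+-assoc (bit (p (f Fin.zero , true))) _ _)) (cong (_ +_) (countB-states K (f ∘′ Fin.suc) p))

code-once : ∀ K v → v < 2 * K → sumFin K (λ i → bit (v ≡ᵇ encode (toℕ i , true)) + bit (v ≡ᵇ encode (toℕ i , false))) ≡ 1
code-once (suc K) v v< with sumFin-cong K (λ i → cong₂ (λ x y → bit (v ≡ᵇ x) + bit (v ≡ᵇ y)) (encode-suc (toℕ i) true) (encode-suc (toℕ i) false))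
code-once (suc K) zero _ | e = cong suc (trans e (sumFin-0 K _ (λ _ → refl)))
code-once (suc K) (suc zero) _ | e = cong suc (trans e (sumFin-0 K _ (λ _ → refl)))
code-once (suc K) (suc (suc v)) v< | e = trans e (code-once K v (≤-pred (≤-pred (subst (suc (suc (suc v)) ≤_) (*-suc 2 K) v<))))

states-once : ∀ m (s : Fin (m + m) × Bool) → countB (λ t → code {m} s ≡ᵇ code {m} t) (states m) ≡ 1
states-once m (c , d) = trans (countB-states (m + m) id _) (code-once (m + m) (code {m} (c , d)) (encode< (toℕ c , d) (toℕ<n c)))

-- `orbits` counts the states of least code in their orbit, and every orbit has exactly one.
module OrbitCount (m : ℕ) (B : Bouquet (suc m)) {L : ℕ} (lab : OrbitLabelling (BouquetDiagram.D m B) L) where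
  open BouquetDiagram m B
  open OrbitLabelling lab

  S : Set
  S = Fin K × Bool

  code′ : S → ℕ
  code′ = code {suc m}

  g : S → ℕ
  g s = label (arrival s)

  g-faceStep : ∀ s → g (faceStep B s) ≡ g s
  g-faceStep s = trans (cong label (arrival-faceStep s)) (label-step (arrival-inRange s))

  g-iter : ∀ k s → g (iter (faceStep B) k s) ≡ g s
  g-iter zero    s = refl
  g-iter (suc k) s = trans (g-faceStep (iter (faceStep B) k s)) (g-iter k s)

  iter-arrival : ∀ j {s t} → iter (step D) j (arrival s) ≡ arrival t → iter (faceStep B) j s ≡ t
  iter-arrival j {s} {t} e = arrival-injective _ t (trans (arrival-iter j s) e)

  2K≡ : 2 * K ≡ 4 * suc m
  2K≡ = trans (*-distribˡ-+ 2 (suc m) (suc m)) (sym (*-distribʳ-+ (suc m) 2 2))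

  reach-bounded : ∀ s t → g s ≡ g t → ∃ λ k → k < 4 * suc m × iter (faceStep B) k s ≡ t
  reach-bounded s t e = shrink (reaches-bounded valid (arrival-inRange s) (label⇒reaches (arrival-inRange s) (arrival-inRange t) e))
    where
    shrink : (∃ λ k → k < 2 * K × iter (step D) k (arrival s) ≡ arrival t) → ∃ λ k → k < 4 * suc m × iter (faceStep B) k s ≡ t
    shrink (k , k< , ek) = k , subst (k <_) 2K≡ k< , iter-arrival k ek

  isMin : S → Bool
  isMin s = and (map (λ k → code′ s ≤ᵇ code′ (iter (faceStep B) k s)) (upTo (4 * suc m)))

  isMin⇒least : ∀ {s} → isMin s ≡ true → ∀ t → g t ≡ g s → code′ s ≤ code′ t
  isMin⇒least {s} e t gt = bound (reach-bounded s t (sym gt))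
    where
    bound : (∃ λ k → k < 4 * suc m × iter (faceStep B) k s ≡ t) → code′ s ≤ code′ t
    bound (k , k< , ek) = subst (λ u → code′ s ≤ code′ u) ek
      (≤ᵇ-true⇒≤ (and-applyUpTo⇒ (λ k → code′ s ≤ᵇ code′ (iter (faceStep B) k s)) id (4 * suc m) e k<))

  least⇒isMin : ∀ {s} → (∀ t → g t ≡ g s → code′ s ≤ code′ t) → isMin s ≡ true
  least⇒isMin {s} h = ⇒and-applyUpTo (λ k → code′ s ≤ᵇ code′ (iter (faceStep B) k s)) id (4 * suc m)
    λ {k} _ → ≤⇒≤ᵇ-true (h (iter (faceStep B) k s) (g-iter k s))

  code-injective : ∀ s t → code′ s ≡ code′ t → s ≡ t
  code-injective (c , d) (c′ , d′) e with encode-injective (toℕ c , d) (toℕ c′ , d′) e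
  ... | e′ = cong₂ _,_ (toℕ-injective (cong proj₁ e′)) (cong proj₂ e′)

  Least : ℕ → S → Set
  Least l s = g s ≡ l × (∀ t → g t ≡ l → code′ s ≤ code′ t)

  smaller : ℕ → S → S → Bool
  smaller l s t = (g t ≡ᵇ l) ∧ (code′ t <ᵇ code′ s)

  least-exists : ∀ l k s → code′ s < k → g s ≡ l → ∃ (Least l)
  least-exists l (suc k) s c< gs with countB (smaller l s) (states (suc m)) in eq
  ... | zero = s , gs , λ t gt → ≮⇒≥ λ t<s → case (begin
      1                                                              ≡⟨ sym (states-once (suc m) t) ⟩
      countB (λ x → code′ t ≡ᵇ code′ x) (states (suc m)) ≤⟨ countB-mono (states (suc m)) (t-smaller t gt t<s) ⟩
      countB (smaller l s) (states (suc m))                          ≡⟨ eq ⟩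
      0                                                              ∎) of λ ()
    where
    open ≤-Reasoning
    t-smaller : ∀ t → g t ≡ l → code′ t < code′ s → ∀ x → (code′ t ≡ᵇ code′ x) ≡ true → smaller l s x ≡ true
    t-smaller t gt t<s x e = subst (λ z → smaller l s z ≡ true) (code-injective t x (≡ᵇ-true⇒≡ e)) (cong₂ _∧_ (≡⇒≡ᵇ-true gt) (<⇒<ᵇ-true t<s))
  ... | suc _ with countB-witness (smaller l s) (states (suc m)) (λ e → 0≢1+n (trans (sym e) eq))
  ...   | t , st = least-exists l k t (≤-trans (<ᵇ-true⇒< (∧-conicalʳ _ _ st)) (≤-pred c<)) (≡ᵇ-true⇒≡ (∧-conicalˡ _ _ st))

  once-per-label : ∀ {l} → l < L → countB (λ x → isMin x ∧ (g x ≡ᵇ l)) (states (suc m)) ≡ 1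
  once-per-label {l} l< = from-least (from-state (label-onto l<))
    where
    from-state : (∃ λ x → InRange D x × label x ≡ l) → ∃ (Least l)
    from-state (x , x< , ex) with arrival-onto {x} x<
    ... | s , e = least-exists l (suc (code′ s)) s ≤-refl (trans (cong label e) ex)
    from-least : ∃ (Least l) → countB (λ x → isMin x ∧ (g x ≡ᵇ l)) (states (suc m)) ≡ 1
    from-least (s* , gs* , min) = trans (countB-cong (states (suc m)) pointwise) (states-once (suc m) s*)
      where
      pointwise : ∀ x → (isMin x ∧ (g x ≡ᵇ l)) ≡ (code′ s* ≡ᵇ code′ x)
      pointwise x with code′ s* ≟ code′ x
      ... | yes e rewrite sym (code-injective s* x e) | ≡⇒≡ᵇ-true {code′ s*} refl
        = cong₂ _∧_ (least⇒isMin (λ t gt → min t (trans gt gs*))) (≡⇒≡ᵇ-true gs*)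
      ... | no ne rewrite ≢⇒≡ᵇ-false ne with isMin x in im | g x ≟ l
      ...   | false | _     = refl
      ...   | true  | no gx≢ = ≢⇒≡ᵇ-false gx≢
      ...   | true  | yes gx = ⊥-elim (ne (≤-antisym (min x gx) (isMin⇒least im s* (trans gs* (sym gx)))))

  orbits≡ : orbits B ≡ L
  orbits≡ = trans (countB-byValue L g isMin (states (suc m)) (λ x → label< (arrival-inRange x))) (sumTo-1 L once-per-label)

-- Counting subsets

_≟ᵛ_ : ∀ {n} → DecidableEquality (Vec Bool n)
_≟ᵛ_ = ≡-dec-Vec _≟ᵇ_

same : ∀ {n} → Vec Bool n → Vec Bool n → Bool
same v w = does (v ≟ᵛ w)

same-refl : ∀ {n} (v : Vec Bool n) → same v v ≡ true
same-refl v = dec-true (v ≟ᵛ v) refl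

same⇒≡ : ∀ {n} {v w : Vec Bool n} → same v w ≡ true → v ≡ w
same⇒≡ {v = v} {w} e with v ≟ᵛ w
... | yes v≡w = v≡w

allSubsets-once : ∀ n (v : Vec Bool n) → countB (same v) (allSubsets n) ≡ 1
allSubsets-once zero    [] = refl
allSubsets-once (suc n) (b ∷ v) = begin
  countB (same (b ∷ v)) (map (true ∷_) (allSubsets n) ++ map (false ∷_) (allSubsets n))
    ≡⟨ countB-++ (same (b ∷ v)) (map (true ∷_) (allSubsets n)) (map (false ∷_) (allSubsets n)) ⟩
  countB (same (b ∷ v)) (map (true ∷_) (allSubsets n)) + countB (same (b ∷ v)) (map (false ∷_) (allSubsets n))
    ≡⟨ cong₂ _+_ (countB-map (same (b ∷ v)) (true ∷_) (allSubsets n)) (countB-map (same (b ∷ v)) (false ∷_) (allSubsets n)) ⟩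
  countB (λ w → same (b ∷ v) (true ∷ w)) (allSubsets n) + countB (λ w → same (b ∷ v) (false ∷ w)) (allSubsets n)
    ≡⟨ by-head b ⟩
  1 ∎
  where
  open ≡-Reasoning
  by-head : ∀ b → countB (λ w → same (b ∷ v) (true ∷ w)) (allSubsets n) + countB (λ w → same (b ∷ v) (false ∷ w)) (allSubsets n) ≡ 1
  by-head true  = cong₂ _+_ (allSubsets-once n v) (countB-none _ (allSubsets n) (λ _ → refl))
  by-head false = cong₂ _+_ (countB-none _ (allSubsets n) (λ _ → refl)) (allSubsets-once n v)

pick : ∀ {X : Set} (p : X → Bool) xs → countB p xs ≢ 0 → ∃ λ ys → ∃ λ y → ∃ λ zs → p y ≡ true × xs ≡ ys ++ y ∷ zs
pick p []       ne = ⊥-elim (ne refl)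
pick p (x ∷ xs) ne with p x in e
... | true  = [] , x , xs , e , refl
... | false with ys , y , zs , py , refl ← pick p xs ne = x ∷ ys , y , zs , py , refl

countB-middle : ∀ {X : Set} (q : X → Bool) ys x zs → countB q (ys ++ x ∷ zs) ≡ bit (q x) + countB q (ys ++ zs)
countB-middle q ys x zs = begin
  countB q (ys ++ x ∷ zs)                     ≡⟨ countB-++ q ys (x ∷ zs) ⟩
  countB q ys + (bit (q x) + countB q zs)     ≡⟨ +-comm-middle (countB q ys) (bit (q x)) (countB q zs) ⟩
  bit (q x) + (countB q ys + countB q zs)     ≡⟨ cong (bit (q x) +_) (sym (countB-++ q ys zs)) ⟩
  bit (q x) + countB q (ys ++ zs)             ∎
  where
  open ≡-Reasoning
  +-comm-middle : ∀ a b c → a + (b + c) ≡ b + (a + c)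
  +-comm-middle a b c = trans (sym (+-assoc a b c)) (trans (cong (_+ c) (+-comm a b)) (+-assoc b a c))

countB-multiplicities : ∀ {n} (xs ys : List (Vec Bool n)) → (∀ v → countB (same v) xs ≡ countB (same v) ys) →
  ∀ h → countB h xs ≡ countB h ys
countB-multiplicities [] [] _ h = refl
countB-multiplicities [] (y ∷ ys) e h with () ← trans (e y) (cong (λ b → bit b + countB (same y) ys) (same-refl y))
countB-multiplicities (x ∷ xs) ys e h
  with ys₁ , y , ys₂ , x≈y , refl ← pick (same x) ys (λ c → 1+n≢0 (trans (sym (cong (λ b → bit b + countB (same x) xs) (same-refl x))) (trans (e x) c)))
  with refl ← same⇒≡ {v = x} {y} x≈y
  = trans (cong (bit (h x) +_) (countB-multiplicities xs (ys₁ ++ ys₂) rest h)) (sym (countB-middle h ys₁ x ys₂))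
  where
  rest : ∀ v → countB (same v) xs ≡ countB (same v) (ys₁ ++ ys₂)
  rest v = +-cancelˡ-≡ (bit (same v x)) _ _ (trans (e v) (countB-middle (same v) ys₁ x ys₂))

countB-bijection : ∀ n (β β′ : Vec Bool n → Vec Bool n) → (∀ v → β′ (β v) ≡ v) → (∀ v → β (β′ v) ≡ v) →
  ∀ h → countB (h ∘′ β) (allSubsets n) ≡ countB h (allSubsets n)
countB-bijection n β β′ β′β ββ′ h = trans (sym (countB-map h β (allSubsets n))) (countB-multiplicities (map β (allSubsets n)) (allSubsets n) multiplicity h)
  where
  multiplicity : ∀ w → countB (same w) (map β (allSubsets n)) ≡ countB (same w) (allSubsets n)
  multiplicity w = begin
    countB (same w) (map β (allSubsets n))  ≡⟨ countB-map (same w) β (allSubsets n) ⟩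
    countB (same w ∘′ β) (allSubsets n)     ≡⟨ countB-cong (allSubsets n) preimage ⟩
    countB (same (β′ w)) (allSubsets n)     ≡⟨ trans (allSubsets-once n (β′ w)) (sym (allSubsets-once n w)) ⟩
    countB (same w) (allSubsets n)          ∎
    where
    open ≡-Reasoning
    preimage : ∀ v → same w (β v) ≡ same (β′ w) v
    preimage v with β′ w ≟ᵛ v
    ... | yes refl = dec-true (w ≟ᵛ β (β′ w)) (sym (ββ′ w))
    ... | no ne    = dec-false (w ≟ᵛ β v) (λ e → ne (trans (cong β′ e) (β′β v)))

-- Counting twist sequences

countLists : ∀ n → (List Bool → Bool) → ℕ
countLists n P = countB (P ∘′ toList) (allSubsets n)

countLists-suc : ∀ n P → countLists (suc n) P ≡ countLists n (P ∘′ (true ∷_)) + countLists n (P ∘′ (false ∷_))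
countLists-suc n P = trans (countB-++ (P ∘′ toList) (map (true ∷_) (allSubsets n)) (map (false ∷_) (allSubsets n)))
  (cong₂ _+_ (countB-map (P ∘′ toList) (true ∷_) (allSubsets n)) (countB-map (P ∘′ toList) (false ∷_) (allSubsets n)))

countLists-cong : ∀ n {P Q} → (∀ l → P l ≡ Q l) → countLists n P ≡ countLists n Q
countLists-cong n e = countB-cong (allSubsets n) (λ v → e (toList v))

countLists-complement : ∀ n P → countLists n P + countLists n (not ∘′ P) ≡ 2 ^ n
countLists-complement zero    P with P []
... | true  = refl
... | false = refl
countLists-complement (suc n) P = begin
  countLists (suc n) P + countLists (suc n) (not ∘′ P)
    ≡⟨ cong₂ _+_ (countLists-suc n P) (countLists-suc n (not ∘′ P)) ⟩
  (countLists n (P ∘′ (true ∷_)) + countLists n (P ∘′ (false ∷_))) + (countLists n (not ∘′ P ∘′ (true ∷_)) + countLists n (not ∘′ P ∘′ (false ∷_)))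
    ≡⟨ interchange (countLists n (P ∘′ (true ∷_))) _ _ _ ⟩
  (countLists n (P ∘′ (true ∷_)) + countLists n (not ∘′ P ∘′ (true ∷_))) + (countLists n (P ∘′ (false ∷_)) + countLists n (not ∘′ P ∘′ (false ∷_)))
    ≡⟨ cong₂ _+_ (countLists-complement n (P ∘′ (true ∷_))) (countLists-complement n (P ∘′ (false ∷_))) ⟩
  2 ^ n + 2 ^ n
    ≡⟨ cong (2 ^ n +_) (sym (+-identityʳ (2 ^ n))) ⟩
  2 ^ suc n ∎
  where open ≡-Reasoning

oneFace twoFaces : ℕ → ℕ
oneFace  n = countLists n continuant
twoFaces n = countLists n (not ∘′ continuant)

oneFace+twoFaces : ∀ n → oneFace n + twoFaces n ≡ 2 ^ n
oneFace+twoFaces n = countLists-complement n continuant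

-- Split off the first two twists: continuant (t ∷ u ∷ r) is continuant r when t = 0,
-- and continuant (not u ∷ r) when t = 1.
twoFaces-rec : ∀ n → twoFaces (2 + n) ≡ twoFaces (1 + n) + 2 * twoFaces n
twoFaces-rec n = begin
  twoFaces (2 + n)
    ≡⟨ countLists-suc (suc n) (not ∘′ continuant) ⟩
  countLists (suc n) (λ l → not (continuant (true ∷ l))) + countLists (suc n) (λ l → not (continuant (false ∷ l)))
    ≡⟨ cong₂ _+_ (countLists-suc n (λ l → not (continuant (true ∷ l)))) (countLists-suc n (λ l → not (continuant (false ∷ l)))) ⟩
  (countLists n (λ r → not (continuant (true ∷ true ∷ r))) + countLists n (λ r → not (continuant (true ∷ false ∷ r)))) + (twoFaces n + twoFaces n)
    ≡⟨ cong (_+ (twoFaces n + twoFaces n)) (trans (cong₂ _+_ (countLists-cong n (λ r → cong not (sym (continuant-not true r))))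
                                                           (countLists-cong n (λ r → cong not (sym (continuant-not false r)))))
                                                (+-comm (countLists n (λ r → not (continuant (false ∷ r)))) (countLists n (λ r → not (continuant (true ∷ r)))))) ⟩
  (countLists n (λ r → not (continuant (true ∷ r))) + countLists n (λ r → not (continuant (false ∷ r)))) + (twoFaces n + twoFaces n)
    ≡⟨ cong₂ _+_ (sym (countLists-suc n (not ∘′ continuant))) (cong (twoFaces n +_) (sym (+-identityʳ (twoFaces n)))) ⟩
  twoFaces (1 + n) + 2 * twoFaces n ∎
  where open ≡-Reasoning

even : ℕ → Bool
even zero    = true
even (suc n) = not (even n)

even≡n%2≡0 : ∀ n → (n % 2 ≡ᵇ 0) ≡ even n
even≡n%2≡0 zero          = refl
even≡n%2≡0 (suc zero)    = refl
even≡n%2≡0 (suc (suc n)) = trans (cong (_≡ᵇ 0) (trans (cong (_% 2) (+-comm 2 n)) ([m+n]%n≡m%n n 2))) (trans (even≡n%2≡0 n) (sym (not-involutive (even n))))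

TwoFacesClosedForm : ℕ → Set
TwoFacesClosedForm n = (even n ≡ true × 3 * twoFaces n + 1 ≡ 2 ^ n) ⊎ (even n ≡ false × 3 * twoFaces n ≡ 2 ^ n + 1)

twoFaces-closedForm : ∀ n → TwoFacesClosedForm n
twoFaces-closedForm n = proj₁ (consecutive n)
  where
  consecutive : ∀ n → TwoFacesClosedForm n × TwoFacesClosedForm (suc n)
  consecutive zero    = inj₁ (refl , refl) , inj₂ (refl , refl)
  consecutive (suc n) with consecutive n
  ... | c₀ , c₁ = c₁ , next-form c₀ c₁
    where
    a = twoFaces n
    b = twoFaces (suc n)
    p = 2 ^ n
    next-form : TwoFacesClosedForm n → TwoFacesClosedForm (suc n) → TwoFacesClosedForm (suc (suc n))
    next-form (inj₁ (e₀ , h₀)) (inj₁ (e₁ , _)) = ⊥-elim (true≢false (trans (sym e₁) (cong not e₀)))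
    next-form (inj₂ (e₀ , _))  (inj₂ (e₁ , _)) = ⊥-elim (true≢false (trans (sym (cong not e₀)) e₁))
    next-form (inj₁ (e₀ , h₀)) (inj₂ (_ , h₁)) = inj₁ (trans (not-involutive (even n)) e₀ , +-cancelʳ-≡ 2 _ _ (begin
      3 * twoFaces (2 + n) + 1 + 2   ≡⟨ cong (λ z → 3 * z + 1 + 2) (twoFaces-rec n) ⟩
      3 * (b + 2 * a) + 1 + 2        ≡⟨ solve 2 (λ a b → con 3 :* (b :+ con 2 :* a) :+ con 1 :+ con 2 := con 3 :* b :+ con 1 :+ con 2 :* (con 3 :* a :+ con 1)) refl a b ⟩
      3 * b + 1 + 2 * (3 * a + 1)    ≡⟨ cong₂ (λ u v → u + 1 + 2 * v) h₁ h₀ ⟩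
      2 ^ suc n + 1 + 1 + 2 * p      ≡⟨ solve 1 (λ p → con 2 :* p :+ con 1 :+ con 1 :+ con 2 :* p := con 2 :* (con 2 :* p) :+ con 2) refl p ⟩
      2 ^ suc (suc n) + 2            ∎))
      where open ≡-Reasoning
    next-form (inj₂ (e₀ , h₀)) (inj₁ (_ , h₁)) = inj₂ (trans (not-involutive (even n)) e₀ , +-cancelʳ-≡ 1 _ _ (begin
      3 * twoFaces (2 + n) + 1       ≡⟨ cong (λ z → 3 * z + 1) (twoFaces-rec n) ⟩
      3 * (b + 2 * a) + 1            ≡⟨ solve 2 (λ a b → con 3 :* (b :+ con 2 :* a) :+ con 1 := con 3 :* b :+ con 1 :+ con 2 :* (con 3 :* a)) refl a b ⟩
      3 * b + 1 + 2 * (3 * a)        ≡⟨ cong₂ (λ u v → u + 2 * v) h₁ h₀ ⟩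
      2 ^ suc n + 2 * (p + 1)        ≡⟨ solve 1 (λ p → con 2 :* p :+ con 2 :* (p :+ con 1) := con 2 :* (con 2 :* p) :+ con 1 :+ con 1) refl p ⟩
      2 ^ suc (suc n) + 1 + 1        ∎))
      where open ≡-Reasoning

genusIs : ℕ → ℕ → List Bool → Bool
genusIs m k l = (if continuant l then suc m else m) ≡ᵇ k

private
  /3 : ∀ x → (3 * x) / 3 ≡ x
  /3 x = trans (cong (_/ 3) (*-comm 3 x)) (m*n/n≡m x 3)

  oneFace-even : ∀ n → 3 * twoFaces n + 1 ≡ 2 ^ n → 3 * oneFace n ≡ 2 ^ (n + 1) + 1
  oneFace-even n h = +-cancelʳ-≡ (2 ^ n) _ _ (begin
    3 * b + 2 ^ n           ≡⟨ cong (3 * b +_) (sym h) ⟩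
    3 * b + (3 * a + 1)     ≡⟨ solve 2 (λ a b → con 3 :* b :+ (con 3 :* a :+ con 1) := con 3 :* (b :+ a) :+ con 1) refl a b ⟩
    3 * (b + a) + 1         ≡⟨ cong (λ z → 3 * z + 1) (oneFace+twoFaces n) ⟩
    3 * 2 ^ n + 1           ≡⟨ solve 1 (λ p → con 3 :* p :+ con 1 := con 2 :* p :+ con 1 :+ p) refl (2 ^ n) ⟩
    2 * 2 ^ n + 1 + 2 ^ n   ≡⟨ cong (λ z → 2 ^ z + 1 + 2 ^ n) (+-comm 1 n) ⟩
    2 ^ (n + 1) + 1 + 2 ^ n ∎)
    where
    open ≡-Reasoning
    a = twoFaces n
    b = oneFace n

  oneFace-odd : ∀ n → 3 * twoFaces n ≡ 2 ^ n + 1 → 3 * oneFace n + 1 ≡ 2 ^ (n + 1)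
  oneFace-odd n h = +-cancelʳ-≡ (2 ^ n) _ _ (begin
    3 * b + 1 + 2 ^ n       ≡⟨ solve 2 (λ b p → con 3 :* b :+ con 1 :+ p := con 3 :* b :+ (p :+ con 1)) refl b (2 ^ n) ⟩
    3 * b + (2 ^ n + 1)     ≡⟨ cong (3 * b +_) (sym h) ⟩
    3 * b + 3 * a           ≡⟨ sym (*-distribˡ-+ 3 b a) ⟩
    3 * (b + a)             ≡⟨ cong (3 *_) (oneFace+twoFaces n) ⟩
    3 * 2 ^ n               ≡⟨ solve 1 (λ p → con 3 :* p := con 2 :* p :+ p) refl (2 ^ n) ⟩
    2 * 2 ^ n + 2 ^ n       ≡⟨ cong (λ z → 2 ^ z + 2 ^ n) (+-comm 1 n) ⟩
    2 ^ (n + 1) + 2 ^ n     ∎)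
    where
    open ≡-Reasoning
    a = twoFaces n
    b = oneFace n

twoFaces≡ : ∀ n → twoFaces n ≡ (if even n then (2 ^ n ∸ 1) / 3 else (2 ^ n + 1) / 3)
twoFaces≡ n with twoFaces-closedForm n
... | inj₁ (e , h) rewrite e | sym h = sym (trans (cong (_/ 3) (m+n∸n≡m (3 * twoFaces n) 1)) (/3 (twoFaces n)))
... | inj₂ (e , h) rewrite e | sym h = sym (/3 (twoFaces n))

oneFace≡ : ∀ n → oneFace n ≡ (if even n then (2 ^ (n + 1) + 1) / 3 else (2 ^ (n + 1) ∸ 1) / 3)
oneFace≡ n with twoFaces-closedForm n
... | inj₁ (e , h) rewrite e | sym (oneFace-even n h) = sym (/3 (oneFace n))
... | inj₂ (e , h) rewrite e | sym (oneFace-odd n h) = sym (trans (cong (_/ 3) (m+n∸n≡m (3 * oneFace n) 1)) (/3 (oneFace n)))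

genusCount : ∀ m k → countLists (suc m) (genusIs m k) ≡ pathTarget (suc m) k
genusCount m k rewrite even≡n%2≡0 (suc m) with k ≟ m | k ≟ suc m
... | yes refl | _ rewrite ≡⇒≡ᵇ-true {k} refl =
  trans (countLists-cong (suc m) (λ l → by-continuant (continuant l))) (twoFaces≡ (suc m))
  where
  by-continuant : ∀ b → ((if b then suc k else k) ≡ᵇ k) ≡ not b
  by-continuant true  = ≢⇒≡ᵇ-false (λ e → <-irrefl (sym e) (n<1+n k))
  by-continuant false = ≡⇒≡ᵇ-true {k} refl
... | no k≢m | yes refl rewrite ≢⇒≡ᵇ-false k≢m | ≡⇒≡ᵇ-true {k} refl =
  trans (countLists-cong (suc m) (λ l → by-continuant (continuant l))) (oneFace≡ (suc m))
  where
  by-continuant : ∀ b → ((if b then suc m else m) ≡ᵇ suc m) ≡ b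
  by-continuant true  = ≡⇒≡ᵇ-true {suc m} refl
  by-continuant false = ≢⇒≡ᵇ-false (λ e → <-irrefl e (n<1+n m))
... | no k≢m | no k≢n rewrite ≢⇒≡ᵇ-false k≢m | ≢⇒≡ᵇ-false k≢n =
  trans (countB-none _ (allSubsets (suc m)) (λ v → neither (continuant (toList v)))) (sym (if-same (even (suc m))))
  where
  neither : ∀ b → ((if b then suc m else m) ≡ᵇ k) ≡ false
  neither true  = ≢⇒≡ᵇ-false (λ e → k≢n (sym e))
  neither false = ≢⇒≡ᵇ-false (λ e → k≢m (sym e))
  if-same : ∀ b → (if b then 0 else 0) ≡ 0
  if-same true  = refl
  if-same false = refl

-- Partial Petrials of a path bouquet

toList-tabulate : ∀ k (f : ℕ → Bool) → toList (tabulate {n = k} (f ∘′ toℕ)) ≡ applyUpTo f k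
toList-tabulate zero    f = refl
toList-tabulate (suc k) f = cong (f 0 ∷_) (toList-tabulate k (f ∘′ suc))

module PartialPetrials (m : ℕ) (B : Bouquet (suc m)) (σ : Fin (suc m) ↔ Fin (suc m))
  (H : ∀ e f → Interlaced B e f ⇔ PathAdj (Inverse.to σ e) (Inverse.to σ f)) where

  pathTwist : Subset (suc m) → Fin (suc m) → Bool
  pathTwist A j = twist B (Inverse.from σ j) xor lookup A (Inverse.from σ j)

  pathTwists : Subset (suc m) → Vec Bool (suc m)
  pathTwists A = tabulate (pathTwist A)

  edgeToggle : Vec Bool (suc m) → Fin (suc m) → Bool
  edgeToggle V e = lookup V (Inverse.to σ e) xor twist B e

  fromPathTwists : Vec Bool (suc m) → Subset (suc m)
  fromPathTwists V = tabulate (edgeToggle V)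

  from∘pathTwists : ∀ A → fromPathTwists (pathTwists A) ≡ A
  from∘pathTwists A = trans (tabulate-cong λ e → begin
      lookup (pathTwists A) (Inverse.to σ e) xor twist B e
        ≡⟨ cong (_xor twist B e) (lookup∘tabulate (pathTwist A) (Inverse.to σ e)) ⟩
      (twist B (Inverse.from σ (Inverse.to σ e)) xor lookup A (Inverse.from σ (Inverse.to σ e))) xor twist B e
        ≡⟨ cong (λ x → (twist B x xor lookup A x) xor twist B e) (Inverse.inverseʳ σ refl) ⟩
      (twist B e xor lookup A e) xor twist B e
        ≡⟨ xor-cancel (twist B e) (lookup A e) ⟩
      lookup A e ∎)
    (tabulate∘lookup A)
    where
    open ≡-Reasoning
    xor-cancel : ∀ x y → (x xor y) xor x ≡ y
    xor-cancel true  y = trans (xor-comm (not y) true) (not-involutive y)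
    xor-cancel false y = xor-identityʳ y

  pathTwists∘from : ∀ V → pathTwists (fromPathTwists V) ≡ V
  pathTwists∘from V = trans (tabulate-cong λ j → begin
      twist B (Inverse.from σ j) xor lookup (fromPathTwists V) (Inverse.from σ j)
        ≡⟨ cong (twist B (Inverse.from σ j) xor_) (lookup∘tabulate (edgeToggle V) (Inverse.from σ j)) ⟩
      twist B (Inverse.from σ j) xor (lookup V (Inverse.to σ (Inverse.from σ j)) xor twist B (Inverse.from σ j))
        ≡⟨ cong (λ x → twist B (Inverse.from σ j) xor (lookup V x xor twist B (Inverse.from σ j))) (Inverse.inverseˡ σ refl) ⟩
      twist B (Inverse.from σ j) xor (lookup V j xor twist B (Inverse.from σ j))
        ≡⟨ xor-cancel′ (twist B (Inverse.from σ j)) (lookup V j) ⟩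
      lookup V j ∎)
    (tabulate∘lookup V)
    where
    open ≡-Reasoning
    xor-cancel′ : ∀ x y → x xor (y xor x) ≡ y
    xor-cancel′ true  y = trans (cong not (xor-comm y true)) (not-involutive y)
    xor-cancel′ false y = xor-identityʳ y

  eulerGenus-partialPetrial : ∀ A → eulerGenus (partialPetrial B A) ≡ (if continuant (toList (pathTwists A)) then suc m else m)
  eulerGenus-partialPetrial A = trans (genus (continuant (applyUpTo P.τ (suc m))) orbits≡′) (cong (λ l → if continuant l then suc m else m) twists)
    where
    -- Interlacing only depends on the ends, so H also applies to the partial Petrial.
    module P = BouquetPath m (partialPetrial B A) σ H
    orbits≡′ : orbits (partialPetrial B A) ≡ faceOrbits (continuant (applyUpTo P.τ (suc m)))
    orbits≡′ = OrbitCount.orbits≡ m (partialPetrial B A) (orbitsByContinuant (suc m) (s≤s z≤n) _ P.label P.τ P.pathLabelling P.twistedBy)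
    genus : ∀ b → orbits (partialPetrial B A) ≡ faceOrbits b → eulerGenus (partialPetrial B A) ≡ (if b then suc m else m)
    genus true  e = cong (λ o → (2 + suc m) ∸ (1 + o / 2)) e
    genus false e = cong (λ o → (2 + suc m) ∸ (1 + o / 2)) e
    twists : applyUpTo P.τ (suc m) ≡ toList (pathTwists A)
    twists = trans (sym (toList-tabulate (suc m) P.τ)) (cong toList (tabulate-cong {f = P.τ ∘′ toℕ} {g = pathTwist A} λ j → cong (λ x → twist B x xor lookup A x) (cong (Inverse.from σ) (P.mod-toℕ j))))

  coefficient : ∀ k → petrialPolyCoeff B k ≡ countLists (suc m) (genusIs m k)
  coefficient k = trans (countB-cong (allSubsets (suc m)) (λ A → cong (_≡ᵇ k) (eulerGenus-partialPetrial A)))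
                        (countB-bijection (suc m) pathTwists fromPathTwists from∘pathTwists pathTwists∘from (genusIs m k ∘′ toList))

theorem4p2 : (n : ℕ) → 1 ≤ n → (B : Bouquet n) → IntersectionGraphIsPath B →
    (k : ℕ) → petrialPolyCoeff B k ≡ pathTarget n k
theorem4p2 (suc m) _ B (σ , H) k = trans (PartialPetrials.coefficient m B σ H k) (genusCount m k)
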